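{- Let $p$ be an odd prime, let $r\in\mathbb{Z}_p$ with $v_p(r)=\alpha>0$, and write $r=p^\alpha s$ with $s\in\mathbb{Z}_p^\times$. Let $$B_\alpha=\{(a,b)\in\mathbb{Z}_p^2 : ab+r\in\square(\mathbb{Z}_p),\ v_p(ab+r)=\alpha\}.$$ Then, with $\mu$ the product of the Haar measures on $\mathbb{Z}_p$ normalized to total mass $1$, $$\mu(B_\alpha)=\begin{cases}\dfrac{(\alpha+1)(p-1)^2}{2p^{\alpha+2}} & \alpha\equiv 0\pmod 2,\ \left(\frac{s}{p}\right)=-1,\\[2mm] \dfrac{\alpha(p-1)^2+p^2+1}{2p^{\alpha+2}} & \alpha\equiv 0\pmod 2,\ \left(\frac{s}{p}\right)=1,\\[2mm] 0 & \alpha\equiv 1\pmod 2.\end{cases}$$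
   Context: $v_p$ is the $p$-adic valuation, $\square(\mathbb{Z}_p)=\{x^2:x\in\mathbb{Z}_p\}$, and $\left(\frac{\cdot}{p}\right)$ is the Legendre symbol applied via reduction mod $p$. -}

module Defs where

open import Data.Nat using (ℕ; zero; suc; _+_; _*_; _∸_; _^_; _<_; NonZero; _≟_)
open import Data.Nat.Properties using (m^n≢0)
open import Data.Nat.DivMod using (_%_)
open import Data.Integer using (ℤ; +_; -[1+_])
open import Data.Fin using (Fin; toℕ)
open import Data.Fin.Properties using (any?)
open import Data.Product using (Σ; _×_; ∃)
open import Data.List using (List; length)
open import Data.List.Membership.Propositional using (_∈_)
open import Data.List.Relation.Unary.Unique.Propositional using (Unique)
open import Function.Bundles using (_⇔_)
open import Relation.Binary.PropositionalEquality using (_≡_; _≢_)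
open import Relation.Nullary using (yes; no)

_mod_^_ : ℕ → (p : ℕ) .{{_ : NonZero p}} → ℕ → ℕ
x mod p ^ n = _%_ x (p ^ n) {{m^n≢0 p n}}

-- p-adic integers as coherent sequences of residues:
-- digit n is the residue mod p^n (0 ≤ digit n < p^n), compatible under reduction.
record ℤp (p : ℕ) .{{_ : NonZero p}} : Set where
  field
    res   : ℕ → ℕ
    res-< : ∀ n → res n < p ^ n
    coh   : ∀ n → (res (suc n)) mod p ^ n ≡ res n
open ℤp public

-- Below, a p-adic integer is also described by any sequence f : ℕ → ℕ of naturals
-- whose reduction mod p^n is its residue mod p^n (e.g. f n = a_n * b_n + r_n for ab+r).

HasVal : (p : ℕ) .{{_ : NonZero p}} → (ℕ → ℕ) → ℕ → Set
HasVal p f α = (f α mod p ^ α ≡ 0) × (f (suc α) mod p ^ (suc α) ≢ 0)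

IsSquare : (p : ℕ) .{{_ : NonZero p}} → (ℕ → ℕ) → Set
IsSquare p f = Σ (ℤp p) λ y → ∀ n → (res y n * res y n) mod p ^ n ≡ f n mod p ^ n

mulAdd : {p : ℕ} .{{_ : NonZero p}} → ℤp p → ℤp p → ℤp p → ℕ → ℕ
mulAdd a b r n = res a n * res b n + res r n

legendre : (p : ℕ) .{{_ : NonZero p}} → ℕ → ℤ
legendre p x with x mod p ^ 1 ≟ 0
... | yes _ = + 0
... | no _ with any? (λ (y : Fin p) → (toℕ y * toℕ y) mod p ^ 1 ≟ x mod p ^ 1)
...   | yes _ = + 1
...   | no _ = -[1+ 0 ]

B : (p : ℕ) .{{_ : NonZero p}} → ℤp p → ℕ → ℤp p → ℤp p → Set
B p r α a b = IsSquare p (mulAdd a b r) × HasVal p (mulAdd a b r) α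

-- Normalised Haar measure on ℤ_p² of a set S, for S a union of cosets of (p^k ℤ_p)²:
-- HasMeasure p S num den  means  μ(S) = num / den.
-- Witness: a level k such that S depends only on residues mod p^k, and a duplicate-free
-- list L of exactly those residue pairs (i , j) mod p^k whose cosets lie in S;
-- then μ(S) = length L / p^(2k).
HasMeasure : (p : ℕ) .{{_ : NonZero p}} → (ℤp p → ℤp p → Set) → ℕ → ℕ → Set
HasMeasure p S num den =
  Σ ℕ λ k →
    (∀ a a' b b' → res a k ≡ res a' k → res b k ≡ res b' k → S a b → S a' b')
  × Σ (List (ℕ × ℕ)) λ L →
      Unique L
    × (∀ i j → ((i Data.Product., j) ∈ L) ⇔ (Σ (ℤp p) λ a → Σ (ℤp p) λ b →
                  (res a k ≡ i) × (res b k ≡ j) × S a b))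
    × (length L * den ≡ num * p ^ (2 * k))

-- Write x = ab + r.  Since v(r) = α, the conditions v(x) = α and x ∈ □(ℤ_p) only depend on
-- a, b mod p^(α+1): by Hensel's lemma, an x of valuation α is a square iff α is even and
-- x/p^α is a nonzero square mod p.  Hence μ(B_α) = C_α / p^(2(α+1)), where C_K counts the pairs
-- (i, j) mod p^(K+1) with ij + p^K s ≡ p^K w for a nonzero quadratic residue w mod p.
-- If i is a unit, j ↦ ij + p^K s permutes the residues mod p^(K+1), so the row contributes
-- (p-1)/2; likewise for columns.  For K ≥ 1 two units never contribute, and if p divides both
-- i and j the condition descends to level K - 2.  This gives
-- C_(K+2) = p² C_K + p^(K+2) (p-1)²  and  C_0 = p [s is a square mod p] + (p-1)²/2,
-- whose solution is the stated formula.

module Submission where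

open import Defs
open import Data.Nat
open import Data.Nat.Properties
open import Data.Nat.DivMod hiding (_mod_)
open import Data.Nat.Divisibility
open import Data.Nat.Primality using (Prime; euclidsLemma; prime⇒nonTrivial; prime⇒irreducible)
open import Data.Nat.Tactic.RingSolver using (solve-∀)
open import Algebra.Properties.CommutativeSemigroup +-commutativeSemigroup using () renaming (interchange to +-interchange)
open import Data.Nat.ListAction using (sum)
open import Data.Nat.ListAction.Properties using (sum-++)
open import Data.Fin as Fin using (Fin; toℕ; fromℕ<)
open import Data.Fin.Properties using (any?; toℕ-fromℕ<; toℕ-injective; toℕ<n; injective⇒≤; punchOut-injective)
import Data.Fin.Permutation as Permutation
import Algebra.Properties.CommutativeMonoid.Sum as FinSum
open import Data.Product using (Σ; ∃; _×_; _,_; proj₁; proj₂; map₁; map₂; uncurry)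
open import Data.Sum using (_⊎_; inj₁; inj₂)
open import Data.Empty using (⊥-elim)
open import Data.List using (List; []; _∷_; _++_; map; filter; length; cartesianProduct; applyUpTo; upTo)
open import Data.List.Properties using (map-++; map-∘; map-applyUpTo)
open import Data.List.Membership.Propositional using (_∈_)
open import Data.List.Membership.Propositional.Properties
  using (∈-filter⁺; ∈-filter⁻; ∈-cartesianProduct⁺; ∈-cartesianProduct⁻; ∈-upTo⁺; ∈-upTo⁻)
open import Data.List.Relation.Unary.Unique.Propositional using (Unique)
import Data.List.Relation.Unary.Unique.Propositional.Properties as Unique
import Data.List.Relation.Unary.AllPairs as AllPairs
open import Function.Base using (_∘_)
open import Function.Bundles using (_⇔_; mk⇔)
open import Function.Definitions using (Injective)
open import Relation.Nullary
open import Relation.Nullary.Decidable using (map′; _×-dec_; ¬?)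
open import Relation.Unary using (Pred; Decidable)
open import Relation.Binary.PropositionalEquality

∑< : ℕ → (ℕ → ℕ) → ℕ
∑< zero    f = 0
∑< (suc n) f = f 0 + ∑< n (f ∘ suc)

syntax ∑< n (λ i → e) = ∑[ i < n ] e

∑-cong : ∀ n {f g : ℕ → ℕ} → (∀ i → i < n → f i ≡ g i) → ∑< n f ≡ ∑< n g
∑-cong zero    f≗g = refl
∑-cong (suc n) f≗g = cong₂ _+_ (f≗g 0 z<s) (∑-cong n (λ i i<n → f≗g (suc i) (s<s i<n)))

∑-+ : ∀ m n f → ∑< (m + n) f ≡ ∑< m f + ∑[ i < n ] f (m + i)
∑-+ zero    n f = refl
∑-+ (suc m) n f = trans (cong (f 0 +_) (∑-+ m n (f ∘ suc))) (sym (+-assoc (f 0) _ _))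

∑-distrib-+ : ∀ n f g → ∑[ i < n ] (f i + g i) ≡ ∑< n f + ∑< n g
∑-distrib-+ zero    f g = refl
∑-distrib-+ (suc n) f g = begin
  f 0 + g 0 + ∑[ i < n ] (f (suc i) + g (suc i))  ≡⟨ cong (f 0 + g 0 +_) (∑-distrib-+ n (f ∘ suc) (g ∘ suc)) ⟩
  f 0 + g 0 + (F + G)                             ≡⟨ +-interchange (f 0) (g 0) F G ⟩
  f 0 + F + (g 0 + G)                             ∎
  where
  open ≡-Reasoning
  F = ∑< n (f ∘ suc)
  G = ∑< n (g ∘ suc)

∑-const : ∀ n c → ∑[ _ < n ] c ≡ n * c
∑-const zero    c = refl
∑-const (suc n) c = cong (c +_) (∑-const n c)

∑-zero : ∀ n {f} → (∀ i → i < n → f i ≡ 0) → ∑< n f ≡ 0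
∑-zero n f≗0 = trans (∑-cong n f≗0) (trans (∑-const n 0) (*-zeroʳ n))

∑-distribˡ-* : ∀ n c f → ∑[ i < n ] (c * f i) ≡ c * ∑< n f
∑-distribˡ-* zero    c f = sym (*-zeroʳ c)
∑-distribˡ-* (suc n) c f =
  trans (cong (c * f 0 +_) (∑-distribˡ-* n c (f ∘ suc))) (sym (*-distribˡ-+ c (f 0) _))

∑-comm : ∀ m n (f : ℕ → ℕ → ℕ) → ∑[ i < m ] ∑[ j < n ] f i j ≡ ∑[ j < n ] ∑[ i < m ] f i j
∑-comm zero    n f = sym (∑-zero n (λ _ _ → refl))
∑-comm (suc m) n f = trans (cong (∑[ j < n ] f 0 j +_) (∑-comm m n (f ∘ suc)))
                           (sym (∑-distrib-+ n (f 0) (λ j → ∑[ i < m ] f (suc i) j)))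

∑-blocks : ∀ m k f → ∑< (m * k) f ≡ ∑[ q < m ] ∑[ r < k ] f (q * k + r)
∑-blocks zero    k f = refl
∑-blocks (suc m) k f = trans (∑-+ k (m * k) f) (cong (∑< k f +_) (trans (∑-blocks m k (λ i → f (k + i)))
  (∑-cong m (λ q _ → ∑-cong k (λ r _ → cong f (sym (+-assoc k (q * k) r)))))))

∑-first : ∀ n f → .{{NonZero n}} → ∑< n f ≡ f 0 + ∑[ i < n ∸ 1 ] f (suc i)
∑-first (suc n) f = refl

∑-periodic : ∀ m N .{{_ : NonZero N}} F → ∑[ q < m * N ] F (q % N) ≡ m * ∑< N F
∑-periodic m N F = trans (∑-blocks m N _) (trans (∑-cong m (λ c _ → ∑-cong N (λ b b<N → cong F (block-% c b b<N))))
                                                 (∑-const m _))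
  where
  block-% : ∀ c b → b < N → (c * N + b) % N ≡ b
  block-% c b b<N = trans (cong (_% N) (+-comm (c * N) b)) (trans ([m+kn]%n≡m%n b c N) (m<n⇒m%n≡m b<N))

∑-multiples-and-rest : ∀ k m .{{_ : NonZero m}} X →
  ∑< (k * m) X ≡ ∑[ q < k ] (X (q * m) + ∑[ r < m ∸ 1 ] X (q * m + suc r))
∑-multiples-and-rest k m X = trans (∑-blocks k m X)
  (∑-cong k (λ q _ → trans (∑-first m (λ r → X (q * m + r)))
                                (cong (_+ ∑[ r < m ∸ 1 ] X (q * m + suc r)) (cong X (+-identityʳ (q * m))))))

injective⇒surjective : ∀ {n} (f : Fin n → Fin n) → Injective _≡_ _≡_ f → ∀ y → ∃ λ x → f x ≡ y
injective⇒surjective {suc m} f f-inj y with any? (λ x → f x Fin.≟ y)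
... | yes hit = hit
... | no miss = ⊥-elim (<-irrefl refl (injective⇒≤ punchOut-inj))
  where
  y≢f : ∀ x → y ≢ f x
  y≢f x y≡fx = miss (x , sym y≡fx)
  punchOut-inj : Injective _≡_ _≡_ (λ x → Fin.punchOut (y≢f x))
  punchOut-inj {a} {b} e = f-inj (punchOut-injective (y≢f a) (y≢f b) e)

module _ where
  open FinSum +-0-commutativeMonoid using (sum-cong-≗; sum-permute) renaming (sum to ∑ᶠ)

  ∑≡∑ᶠ : ∀ n f → ∑< n f ≡ ∑ᶠ (λ (i : Fin n) → f (toℕ i))
  ∑≡∑ᶠ zero    f = refl
  ∑≡∑ᶠ (suc n) f = cong (f 0 +_) (∑≡∑ᶠ n (f ∘ suc))

  ∑-reindex : ∀ n (φ : ℕ → ℕ) → (∀ i → i < n → φ i < n) →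
              (∀ i j → i < n → j < n → φ i ≡ φ j → i ≡ j) →
              ∀ f → ∑[ i < n ] f (φ i) ≡ ∑< n f
  ∑-reindex n φ φ< φ-inj f = begin
    ∑[ i < n ] f (φ i)             ≡⟨ ∑≡∑ᶠ n (f ∘ φ) ⟩
    ∑ᶠ {n} (λ i → f (φ (toℕ i)))   ≡⟨ sum-cong-≗ {n} (λ i → cong f (sym (toℕ-fromℕ< (φ< (toℕ i) (toℕ<n i))))) ⟩
    ∑ᶠ {n} (λ i → f (toℕ (φᶠ i)))  ≡⟨ sum-permute {n} {n} (f ∘ toℕ) π ⟨
    ∑ᶠ {n} (λ i → f (toℕ i))       ≡⟨ ∑≡∑ᶠ n f ⟨
    ∑< n f                         ∎
    where
    open ≡-Reasoning
    φᶠ : Fin n → Fin n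
    φᶠ i = fromℕ< (φ< (toℕ i) (toℕ<n i))
    φᶠ-inj : Injective _≡_ _≡_ φᶠ
    φᶠ-inj {a} {b} e = toℕ-injective (φ-inj (toℕ a) (toℕ b) (toℕ<n a) (toℕ<n b)
      (trans (sym (toℕ-fromℕ< _)) (trans (cong toℕ e) (toℕ-fromℕ< _))))
    φᶠ⁻¹ : Fin n → Fin n
    φᶠ⁻¹ y = proj₁ (injective⇒surjective φᶠ φᶠ-inj y)
    π : Permutation.Permutation n n
    π = Permutation.permutation φᶠ φᶠ⁻¹ (λ y → proj₂ (injective⇒surjective φᶠ φᶠ-inj y))
          (λ x → φᶠ-inj (proj₂ (injective⇒surjective φᶠ φᶠ-inj (φᶠ x))))

𝟙 : ∀ {A : Set} → Dec A → ℕ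
𝟙 (yes _) = 1
𝟙 (no _)  = 0

𝟙-yes : ∀ {A : Set} (a? : Dec A) → A → 𝟙 a? ≡ 1
𝟙-yes (yes _) _ = refl
𝟙-yes (no ¬a) a = ⊥-elim (¬a a)

𝟙-no : ∀ {A : Set} (a? : Dec A) → ¬ A → 𝟙 a? ≡ 0
𝟙-no (yes a) ¬a = ⊥-elim (¬a a)
𝟙-no (no _)  _  = refl

𝟙-cong : ∀ {A B : Set} (a? : Dec A) (b? : Dec B) → (A → B) → (B → A) → 𝟙 a? ≡ 𝟙 b?
𝟙-cong (yes _) (yes _) _ _ = refl
𝟙-cong (yes a) (no ¬b) f _ = ⊥-elim (¬b (f a))
𝟙-cong (no ¬a) (yes b) _ g = ⊥-elim (¬a (g b))
𝟙-cong (no _)  (no _)  _ _ = refl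

∑-𝟙-singleton : ∀ n {P : ℕ → Set} (P? : ∀ i → Dec (P i)) a → a < n → P a →
                (∀ i → i < n → P i → i ≡ a) → ∑[ i < n ] 𝟙 (P? i) ≡ 1
∑-𝟙-singleton (suc n) P? zero _ Pa unique with P? 0
... | no ¬P0 = ⊥-elim (¬P0 Pa)
... | yes _  = cong suc (∑-zero n none)
  where
  none : ∀ i → i < n → 𝟙 (P? (suc i)) ≡ 0
  none i i<n with P? (suc i)
  ... | yes Pi = ⊥-elim (1+n≢0 (unique (suc i) (s<s i<n) Pi))
  ... | no _   = refl
∑-𝟙-singleton (suc n) P? (suc a) (s<s a<n) Pa unique with P? 0
... | yes P0 = ⊥-elim (0≢1+n (unique 0 z<s P0))
... | no _   = ∑-𝟙-singleton n (P? ∘ suc) a a<n Pa (λ i i<n Pi → suc-injective (unique (suc i) (s<s i<n) Pi))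

length-filter≡sum-𝟙 : ∀ {A : Set} {P : Pred A _} (P? : Decidable P) xs →
                      length (filter P? xs) ≡ sum (map (𝟙 ∘ P?) xs)
length-filter≡sum-𝟙 P? []       = refl
length-filter≡sum-𝟙 P? (x ∷ xs) with P? x
... | yes _ = cong suc (length-filter≡sum-𝟙 P? xs)
... | no _  = length-filter≡sum-𝟙 P? xs

sum-map-cartesianProduct : ∀ {A B : Set} (xs : List A) (ys : List B) f →
  sum (map f (cartesianProduct xs ys)) ≡ sum (map (λ x → sum (map (λ y → f (x , y)) ys)) xs)
sum-map-cartesianProduct []       ys f = refl
sum-map-cartesianProduct (x ∷ xs) ys f = begin
  sum (map f (map (x ,_) ys ++ cartesianProduct xs ys))
    ≡⟨ cong sum (map-++ f (map (x ,_) ys) _) ⟩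
  sum (map f (map (x ,_) ys) ++ map f (cartesianProduct xs ys))
    ≡⟨ sum-++ (map f (map (x ,_) ys)) _ ⟩
  sum (map f (map (x ,_) ys)) + sum (map f (cartesianProduct xs ys))
    ≡⟨ cong₂ _+_ (cong sum (sym (map-∘ ys))) (sum-map-cartesianProduct xs ys f) ⟩
  sum (map (λ y → f (x , y)) ys) + sum (map (λ x → sum (map (λ y → f (x , y)) ys)) xs) ∎
  where open ≡-Reasoning

sum-map-upTo : ∀ n f → sum (map f (upTo n)) ≡ ∑< n f
sum-map-upTo n f = trans (cong sum (map-applyUpTo (λ i → i) f n)) (sum-applyUpTo n f)
  where
  sum-applyUpTo : ∀ n f → sum (applyUpTo f n) ≡ ∑< n f
  sum-applyUpTo zero    f = refl
  sum-applyUpTo (suc n) f = cong (f 0 +_) (sum-applyUpTo n (f ∘ suc))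

0%n≡0 : ∀ n .{{_ : NonZero n}} → 0 % n ≡ 0
0%n≡0 n = m*n%n≡0 0 n

+-cancelˡ-% : ∀ M .{{_ : NonZero M}} x y z → (x + y) % M ≡ (x + z) % M → y % M ≡ z % M
+-cancelˡ-% M x y z x+y≡x+z = begin
  y % M                      ≡⟨ %-remove-+ˡ y M∣c+x ⟨
  (c + x + y) % M            ≡⟨ cong (_% M) (+-assoc c x y) ⟩
  (c + (x + y)) % M          ≡⟨ %-distribˡ-+ c (x + y) M ⟩
  (c % M + (x + y) % M) % M  ≡⟨ cong (λ w → (c % M + w) % M) x+y≡x+z ⟩
  (c % M + (x + z) % M) % M  ≡⟨ %-distribˡ-+ c (x + z) M ⟨
  (c + (x + z)) % M          ≡⟨ cong (_% M) (+-assoc c x z) ⟨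
  (c + x + z) % M            ≡⟨ %-remove-+ˡ z M∣c+x ⟩
  z % M                      ∎
  where
  open ≡-Reasoning
  c = M ∸ x % M
  M∣c+x : M ∣ c + x
  M∣c+x = divides (suc (x / M)) (begin
    c + x                    ≡⟨ cong (c +_) (m≡m%n+[m/n]*n x M) ⟩
    c + (x % M + x / M * M)  ≡⟨ +-assoc c (x % M) _ ⟨
    c + x % M + x / M * M    ≡⟨ cong (_+ x / M * M) (m∸n+n≡m (m%n≤n x M)) ⟩
    M + x / M * M            ∎)

module PowerCongruence (p : ℕ) .{{_ : NonZero p}} where

  infixl 7 _mod^_
  _mod^_ : ℕ → ℕ → ℕ
  x mod^ n = x mod p ^ n

  infixl 7 _div^_
  _div^_ : ℕ → ℕ → ℕ
  x div^ n = _/_ x (p ^ n) {{m^n≢0 p n}}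

  infix 4 _≡_[mod^_]
  _≡_[mod^_] : ℕ → ℕ → ℕ → Set
  x ≡ y [mod^ n ] = x mod^ n ≡ y mod^ n

  mod-< : ∀ {n x} → x < p ^ n → x mod^ n ≡ x
  mod-< {n} = m<n⇒m%n≡m
    where instance _ = m^n≢0 p n

  mod-≡ : ∀ n x → x mod^ n ≡ x [mod^ n ]
  mod-≡ n x = m%n%n≡m%n x (p ^ n)
    where instance _ = m^n≢0 p n

  mod-p^1 : ∀ x → x mod^ 1 ≡ x % p
  mod-p^1 x = %-congʳ (*-identityʳ p)
    where instance _ = m^n≢0 p 1

  +-cong-mod : ∀ {n x x′ y y′} → x ≡ x′ [mod^ n ] → y ≡ y′ [mod^ n ] → x + y ≡ x′ + y′ [mod^ n ]
  +-cong-mod {n} {x} {x′} {y} {y′} x≡x′ y≡y′ = begin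
    (x + y) mod^ n                   ≡⟨ %-distribˡ-+ x y (p ^ n) ⟩
    (x mod^ n + y mod^ n) % p ^ n    ≡⟨ cong₂ (λ a b → (a + b) % p ^ n) x≡x′ y≡y′ ⟩
    (x′ mod^ n + y′ mod^ n) % p ^ n  ≡⟨ %-distribˡ-+ x′ y′ (p ^ n) ⟨
    (x′ + y′) mod^ n                 ∎
    where
    open ≡-Reasoning
    instance _ = m^n≢0 p n

  *-cong-mod : ∀ {n x x′ y y′} → x ≡ x′ [mod^ n ] → y ≡ y′ [mod^ n ] → x * y ≡ x′ * y′ [mod^ n ]
  *-cong-mod {n} {x} {x′} {y} {y′} x≡x′ y≡y′ = begin
    (x * y) mod^ n                     ≡⟨ %-distribˡ-* x y (p ^ n) ⟩
    (x mod^ n * (y mod^ n)) % p ^ n    ≡⟨ cong₂ (λ a b → (a * b) % p ^ n) x≡x′ y≡y′ ⟩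
    (x′ mod^ n * (y′ mod^ n)) % p ^ n  ≡⟨ %-distribˡ-* x′ y′ (p ^ n) ⟨
    (x′ * y′) mod^ n                   ∎
    where
    open ≡-Reasoning
    instance _ = m^n≢0 p n

  p^m∣p^n : ∀ {m n} → m ≤ n → p ^ m ∣ p ^ n
  p^m∣p^n {m} {n} m≤n = divides (p ^ (n ∸ m))
    (trans (cong (p ^_) (sym (m∸n+n≡m m≤n))) (^-distribˡ-+-* p (n ∸ m) m))

  mod-mod-≤ : ∀ {m n} x → m ≤ n → x mod^ n mod^ m ≡ x mod^ m
  mod-mod-≤ {m} {n} x m≤n = m∣n⇒o%n%m≡o%m (p ^ m) (p ^ n) x (p^m∣p^n m≤n)
    where
    instance _ = m^n≢0 p m
    instance _ = m^n≢0 p n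

  p^a*-mod : ∀ a b x → (p ^ a * x) mod^ (a + b) ≡ p ^ a * (x mod^ b)
  p^a*-mod a b x = begin
    (p ^ a * x) mod^ (a + b)       ≡⟨ %-congʳ (trans (^-distribˡ-+-* p a b) (*-comm (p ^ a) (p ^ b))) ⟩
    (p ^ a * x) % (p ^ b * p ^ a)  ≡⟨ cong (_% (p ^ b * p ^ a)) (*-comm (p ^ a) x) ⟩
    (x * p ^ a) % (p ^ b * p ^ a)  ≡⟨ m%n*o≡m*o%[n*o] x (p ^ b) (p ^ a) ⟨
    x mod^ b * p ^ a               ≡⟨ *-comm (x mod^ b) (p ^ a) ⟩
    p ^ a * (x mod^ b)             ∎
    where
    open ≡-Reasoning
    instance _ = m^n≢0 p a
    instance _ = m^n≢0 p b
    instance _ = m^n≢0 p (a + b)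
    instance _ = m*n≢0 (p ^ b) (p ^ a)

  p^a*-cancel-mod : ∀ a b x y → p ^ a * x ≡ p ^ a * y [mod^ a + b ] → x ≡ y [mod^ b ]
  p^a*-cancel-mod a b x y eq =
    *-cancelˡ-≡ (x mod^ b) (y mod^ b) (p ^ a) (trans (sym (p^a*-mod a b x)) (trans eq (p^a*-mod a b y)))
    where instance _ = m^n≢0 p a

  mod-suc : ∀ n x → x mod^ suc n ≡ x mod^ n + (x div^ n % p) * p ^ n
  mod-suc n x = begin
    z                                  ≡⟨ m≡m%n+[m/n]*n z (p ^ n) ⟩
    z mod^ n + (z / p ^ n) * p ^ n     ≡⟨ cong₂ (λ a b → a + b * p ^ n) (mod-mod-≤ x (n≤1+n n)) (m%[n*o]/o≡m/o%n x p (p ^ n)) ⟩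
    x mod^ n + (x div^ n % p) * p ^ n  ∎
    where
    open ≡-Reasoning
    z = x mod^ suc n
    instance _ = m^n≢0 p n
    instance _ = m^n≢0 p (suc n)

  ≡-mod-suc : ∀ {n x y} → x ≡ y [mod^ n ] → x div^ n % p ≡ y div^ n % p → x ≡ y [mod^ suc n ]
  ≡-mod-suc {n} {x} {y} x≡y digit≡ =
    trans (mod-suc n x) (trans (cong₂ (λ a b → a + b * p ^ n) x≡y digit≡) (sym (mod-suc n y)))

module PrimeModulus (p : ℕ) .{{_ : NonZero p}} (p-prime : Prime p) where

  open PowerCongruence p

  unit-* : ∀ x y → x % p ≢ 0 → y % p ≢ 0 → (x * y) % p ≢ 0
  unit-* x y x≢0 y≢0 xy≡0 with euclidsLemma x y p-prime (m%n≡0⇒n∣m (x * y) p xy≡0)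
  ... | inj₁ p∣x = x≢0 (n∣m⇒m%n≡0 x p p∣x)
  ... | inj₂ p∣y = y≢0 (n∣m⇒m%n≡0 y p p∣y)

  p^n∣c*x⇒p^n∣x : ∀ n c x → c % p ≢ 0 → p ^ n ∣ c * x → p ^ n ∣ x
  p^n∣c*x⇒p^n∣x zero    c x _   _ = 1∣ x
  p^n∣c*x⇒p^n∣x (suc n) c x c≢0 p^[1+n]∣cx with euclidsLemma c x p-prime (∣-trans (∣m⇒∣m*n (p ^ n) ∣-refl) p^[1+n]∣cx)
  ... | inj₁ p∣c = ⊥-elim (c≢0 (n∣m⇒m%n≡0 c p p∣c))
  ... | inj₂ (divides q refl) =
    subst (p ^ suc n ∣_) (*-comm p q) (*-monoʳ-∣ p (p^n∣c*x⇒p^n∣x n c q c≢0 (*-cancelˡ-∣ p p*p^n∣p*cq)))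
    where
    p*p^n∣p*cq : p * p ^ n ∣ p * (c * q)
    p*p^n∣p*cq = subst (p * p ^ n ∣_) (reassoc c q p) p^[1+n]∣cx
      where
      reassoc : ∀ c q p → c * (q * p) ≡ p * (c * q)
      reassoc = solve-∀

  private
    affine-injective-≤ : ∀ N c a {i j} → c % p ≢ 0 → j < p ^ N → i ≤ j →
                         a + c * i ≡ a + c * j [mod^ N ] → i ≡ j
    affine-injective-≤ N c a {i} {j} c≢0 j<p^N i≤j eq = begin
      i            ≡⟨ +-identityʳ i ⟨
      i + 0        ≡⟨ cong (i +_) d≡0 ⟨
      i + (j ∸ i)  ≡⟨ m+[n∸m]≡n i≤j ⟩
      j            ∎
      where
      open ≡-Reasoning
      instance _ = m^n≢0 p N
      d = j ∸ i
      a+cj : a + c * j ≡ (a + c * i) + c * d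
      a+cj = begin
        a + c * j            ≡⟨ cong (λ z → a + c * z) (m+[n∸m]≡n i≤j) ⟨
        a + c * (i + d)      ≡⟨ cong (a +_) (*-distribˡ-+ c i d) ⟩
        a + (c * i + c * d)  ≡⟨ +-assoc a (c * i) (c * d) ⟨
        a + c * i + c * d    ∎
      cd≡0 : (c * d) mod^ N ≡ 0
      cd≡0 = trans (sym (+-cancelˡ-% (p ^ N) (a + c * i) 0 (c * d)
        (trans (cong (_mod^ N) (+-identityʳ _)) (trans eq (cong (_mod^ N) a+cj))))) (0%n≡0 (p ^ N))
      p^N∣d : p ^ N ∣ d
      p^N∣d = p^n∣c*x⇒p^n∣x N c d c≢0 (m%n≡0⇒n∣m (c * d) (p ^ N) cd≡0)
      d≡0 : d ≡ 0
      d≡0 = trans (sym (mod-< {N} (≤-<-trans (m∸n≤m j i) j<p^N))) (n∣m⇒m%n≡0 d (p ^ N) p^N∣d)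

  affine-injective : ∀ N c a {i j} → c % p ≢ 0 → i < p ^ N → j < p ^ N →
                     a + c * i ≡ a + c * j [mod^ N ] → i ≡ j
  affine-injective N c a {i} {j} c≢0 i< j< eq with ≤-total i j
  ... | inj₁ i≤j = affine-injective-≤ N c a c≢0 j< i≤j eq
  ... | inj₂ j≤i = sym (affine-injective-≤ N c a c≢0 i< j≤i (sym eq))

  affine-surjective : ∀ N c a u → c % p ≢ 0 → ∃ λ j → j < p ^ N × a + c * j ≡ u [mod^ N ]
  affine-surjective N c a u c≢0 =
    toℕ j , toℕ<n j , trans (sym (toℕ-fromℕ< _)) (trans (cong toℕ fj≡u) (toℕ-fromℕ< _))
    where
    instance _ = m^n≢0 p N
    f : Fin (p ^ N) → Fin (p ^ N)
    f j = fromℕ< (m%n<n (a + c * toℕ j) (p ^ N))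
    f-injective : Injective _≡_ _≡_ f
    f-injective {i} {j} e = toℕ-injective (affine-injective N c a c≢0 (toℕ<n i) (toℕ<n j)
      (trans (sym (toℕ-fromℕ< _)) (trans (cong toℕ e) (toℕ-fromℕ< _))))
    j = proj₁ (injective⇒surjective f f-injective (fromℕ< (m%n<n u (p ^ N))))
    fj≡u = proj₂ (injective⇒surjective f f-injective (fromℕ< (m%n<n u (p ^ N))))

∑-𝟙-positive : ∀ n → ∑[ y < n ] 𝟙 (0 <? y) ≡ n ∸ 1
∑-𝟙-positive zero    = refl
∑-𝟙-positive (suc n) = trans (∑-const n 1) (*-identityʳ n)

module QuadraticResidues (p : ℕ) .{{_ : NonZero p}} (p-prime : Prime p) (p≢2 : p ≢ 2) where

  open PowerCongruence p
  open PrimeModulus p p-prime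

  QR : ℕ → Set
  QR d = ∃ λ y → y < p × (y * y) % p ≡ d % p

  UnitQR : ℕ → Set
  UnitQR d = d % p ≢ 0 × QR d

  qr? : ∀ d → Dec (QR d)
  qr? d = map′ (λ (y , e) → toℕ y , toℕ<n y , e)
               (λ (y , y< , e) → fromℕ< y< , subst (λ z → (z * z) % p ≡ d % p) (sym (toℕ-fromℕ< y<)) e)
               (any? (λ (y : Fin p) → (toℕ y * toℕ y) % p ≟ d % p))

  unitQR? : ∀ d → Dec (UnitQR d)
  unitQR? d = ¬? (d % p ≟ 0) ×-dec qr? d

  UnitQR-mod : ∀ d → UnitQR (d % p) → UnitQR d
  UnitQR-mod d (d≢0 , y , y< , y²≡d) = d≢0 ∘ trans (m%n%n≡m%n d p) , y , y< , trans y²≡d (m%n%n≡m%n d p)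

  mod-UnitQR : ∀ d → UnitQR d → UnitQR (d % p)
  mod-UnitQR d (d≢0 , y , y< , y²≡d) = d≢0 ∘ trans (sym (m%n%n≡m%n d p)) , y , y< , trans y²≡d (sym (m%n%n≡m%n d p))

  UnitQRAt : ℕ → ℕ → Set
  UnitQRAt K v = v mod^ K ≡ 0 × UnitQR (v div^ K)

  unitQRAt? : ∀ K v → Dec (UnitQRAt K v)
  unitQRAt? K v = (v mod^ K ≟ 0) ×-dec unitQR? (v div^ K)

  #unitQR : ℕ
  #unitQR = ∑[ d < p ] 𝟙 (unitQR? d)

  private
    p∣n<2p⇒n≡p : ∀ n → 0 < n → n < p + p → p ∣ n → n ≡ p
    p∣n<2p⇒n≡p n 0<n n<2p (divides zero refl)          = ⊥-elim (<-irrefl refl 0<n)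
    p∣n<2p⇒n≡p n 0<n n<2p (divides (suc zero) refl)    = +-identityʳ p
    p∣n<2p⇒n≡p n 0<n n<2p (divides (suc (suc k)) refl) = ⊥-elim (<⇒≱ n<2p (+-monoʳ-≤ p (m≤m+n p (k * p))))

    <p∧p∣⇒≡0 : ∀ {y} → y < p → p ∣ y → y ≡ 0
    <p∧p∣⇒≡0 {y} y<p p∣y = trans (sym (m<n⇒m%n≡m y<p)) (n∣m⇒m%n≡0 y p p∣y)

    square-roots-≤ : ∀ {y t} → y < p → t < p → t ≤ y → (y * y) % p ≡ (t * t) % p → y ≡ t ⊎ y + t ≡ p
    square-roots-≤ {y} {t} y<p t<p t≤y y²≡t²
      with euclidsLemma (y ∸ t) (y + t) p-prime (m%n≡0⇒n∣m _ p [y-t][y+t]≡0)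
      where
      open ≡-Reasoning
      d = y ∸ t
      y≡t+d : y ≡ t + d
      y≡t+d = sym (m+[n∸m]≡n t≤y)
      expand : ∀ t d → (t + d) * (t + d) ≡ t * t + d * ((t + d) + t)
      expand = solve-∀
      y²≡t²+[y-t][y+t] : y * y ≡ t * t + d * (y + t)
      y²≡t²+[y-t][y+t] = begin
        y * y                      ≡⟨ cong (λ z → z * z) y≡t+d ⟩
        (t + d) * (t + d)          ≡⟨ expand t d ⟩
        t * t + d * ((t + d) + t)  ≡⟨ cong (λ z → t * t + d * (z + t)) y≡t+d ⟨
        t * t + d * (y + t)        ∎
      [y-t][y+t]≡0 : (d * (y + t)) % p ≡ 0
      [y-t][y+t]≡0 = trans (sym (+-cancelˡ-% p (t * t) 0 (d * (y + t)) (begin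
        (t * t + 0) % p             ≡⟨ cong (_% p) (+-identityʳ (t * t)) ⟩
        (t * t) % p                 ≡⟨ y²≡t² ⟨
        (y * y) % p                 ≡⟨ cong (_% p) y²≡t²+[y-t][y+t] ⟩
        (t * t + d * (y + t)) % p   ∎))) (0%n≡0 p)
    ... | inj₁ p∣y-t = inj₁ (trans (sym (m+[n∸m]≡n t≤y))
                             (trans (cong (t +_) (<p∧p∣⇒≡0 (≤-<-trans (m∸n≤m y t) y<p) p∣y-t)) (+-identityʳ t)))
    ... | inj₂ p∣y+t with y + t in y+t≡
    ...   | zero  = inj₁ (trans (m+n≡0⇒m≡0 y y+t≡) (sym (m+n≡0⇒n≡0 y y+t≡)))
    ...   | suc n = inj₂ (p∣n<2p⇒n≡p (suc n) z<s (subst (_< p + p) y+t≡ (+-mono-< y<p t<p)) p∣y+t)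

  square-roots : ∀ {y t} → y < p → t < p → (y * y) % p ≡ (t * t) % p → y ≡ t ⊎ y + t ≡ p
  square-roots {y} {t} y<p t<p y²≡t² with ≤-total t y
  ... | inj₁ t≤y = square-roots-≤ y<p t<p t≤y y²≡t²
  ... | inj₂ y≤t with square-roots-≤ t<p y<p y≤t (sym y²≡t²)
  ...   | inj₁ t≡y   = inj₁ (sym t≡y)
  ...   | inj₂ t+y≡p = inj₂ (trans (+-comm y t) t+y≡p)

  [p∸t]²≡t² : ∀ t → t ≤ p → ((p ∸ t) * (p ∸ t)) % p ≡ (t * t) % p
  [p∸t]²≡t² t t≤p = begin
    (u * u) % p                ≡⟨ [m+kn]%n≡m%n (u * u) t p ⟨
    (u * u + t * p) % p        ≡⟨ cong (λ z → (u * u + t * z) % p) u+t≡p ⟨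
    (u * u + t * (u + t)) % p  ≡⟨ cong (_% p) (swap u t) ⟩
    (t * t + u * (u + t)) % p  ≡⟨ cong (λ z → (t * t + u * z) % p) u+t≡p ⟩
    (t * t + u * p) % p        ≡⟨ [m+kn]%n≡m%n (t * t) u p ⟩
    (t * t) % p                ∎
    where
    open ≡-Reasoning
    u = p ∸ t
    u+t≡p : u + t ≡ p
    u+t≡p = m∸n+n≡m t≤p
    swap : ∀ u t → u * u + t * (u + t) ≡ t * t + u * (u + t)
    swap = solve-∀

  t≢p∸t : ∀ t → t ≢ p ∸ t
  t≢p∸t t t≡p∸t
    with prime⇒irreducible p-prime (divides t (trans (sym (m∸n+n≡m t≤p)) (trans (cong (_+ t) (sym t≡p∸t)) (double t))))
    where
    t≤p : t ≤ p
    t≤p = subst (_≤ p) (sym t≡p∸t) (m∸n≤m p t)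
    double : ∀ t → t + t ≡ t * 2
    double = solve-∀
  ... | inj₁ ()
  ... | inj₂ 2≡p = p≢2 (sym 2≡p)

  SquaresTo : ℕ → ℕ → Set
  SquaresTo y d = 0 < y × (y * y) % p ≡ d

  squaresTo? : ∀ y d → Dec (SquaresTo y d)
  squaresTo? y d = (0 <? y) ×-dec ((y * y) % p ≟ d)

  private
    #squares-of-root : ∀ y → ∑[ d < p ] 𝟙 (squaresTo? y d) ≡ 𝟙 (0 <? y)
    #squares-of-root zero    = ∑-zero p (λ _ _ → refl)
    #squares-of-root (suc y) = ∑-𝟙-singleton p (squaresTo? (suc y)) ((suc y * suc y) % p) (m%n<n _ p) (z<s , refl)
                                 (λ _ _ (_ , y²≡d) → sym y²≡d)

    #roots-of-nonresidue : ∀ d → d < p → ¬ UnitQR d → ∑[ y < p ] 𝟙 (squaresTo? y d) ≡ 0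
    #roots-of-nonresidue d d<p ¬qr = ∑-zero p none
      where
      d%p≡d : d % p ≡ d
      d%p≡d = m<n⇒m%n≡m d<p
      none : ∀ y → y < p → 𝟙 (squaresTo? y d) ≡ 0
      none y y<p with squaresTo? y d
      ... | no _ = refl
      ... | yes (0<y , y²≡d) = ⊥-elim (¬qr (d≢0 , y , y<p , trans y²≡d (sym d%p≡d)))
        where
        y≢0 : y % p ≢ 0
        y≢0 y%p≡0 = <⇒≢ 0<y (sym (trans (sym (m<n⇒m%n≡m y<p)) y%p≡0))
        d≢0 : d % p ≢ 0
        d≢0 = subst (λ z → z % p ≢ 0) y²≡d (λ e → unit-* y y y≢0 y≢0 (trans (sym (m%n%n≡m%n (y * y) p)) e))

    #roots-of-residue : ∀ d → d < p → UnitQR d → ∑[ y < p ] 𝟙 (squaresTo? y d) ≡ 2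
    #roots-of-residue d d<p (d≢0 , t , t<p , t²≡d) = begin
      ∑[ y < p ] 𝟙 (squaresTo? y d)                           ≡⟨ ∑-cong p roots ⟩
      ∑[ y < p ] (𝟙 (y ≟ t) + 𝟙 (y ≟ p ∸ t))                  ≡⟨ ∑-distrib-+ p _ _ ⟩
      ∑[ y < p ] 𝟙 (y ≟ t) + ∑[ y < p ] 𝟙 (y ≟ p ∸ t)         ≡⟨ cong₂ _+_ (∑-𝟙-singleton p _ t t<p refl (λ _ _ e → e))
                                                                     (∑-𝟙-singleton p _ (p ∸ t) p∸t<p refl (λ _ _ e → e)) ⟩
      2                                                        ∎
      where
      open ≡-Reasoning
      d%p≡d : d % p ≡ d
      d%p≡d = m<n⇒m%n≡m d<p
      nonzero-root : ∀ t → (t * t) % p ≡ d % p → 0 < t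
      nonzero-root zero    0≡d = ⊥-elim (d≢0 (trans (sym 0≡d) (0%n≡0 p)))
      nonzero-root (suc _) _   = z<s
      0<t : 0 < t
      0<t = nonzero-root t t²≡d
      p∸t<p : p ∸ t < p
      p∸t<p = ∸-monoʳ-< 0<t (<⇒≤ t<p)
      roots : ∀ y → y < p → 𝟙 (squaresTo? y d) ≡ 𝟙 (y ≟ t) + 𝟙 (y ≟ p ∸ t)
      roots y y<p with squaresTo? y d | y ≟ t | y ≟ p ∸ t
      ... | yes _ | yes refl | yes t≡p∸t = ⊥-elim (t≢p∸t t t≡p∸t)
      ... | yes _ | yes _    | no _  = refl
      ... | yes _ | no _     | yes _ = refl
      ... | yes (_ , y²≡d) | no y≢t | no y≢p∸t with square-roots y<p t<p (trans y²≡d (trans (sym d%p≡d) (sym t²≡d)))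
      ...   | inj₁ y≡t   = ⊥-elim (y≢t y≡t)
      ...   | inj₂ y+t≡p = ⊥-elim (y≢p∸t (sym (trans (cong (_∸ t) (sym y+t≡p)) (m+n∸n≡m y t))))
      roots y y<p | no ¬sq | yes refl | _ = ⊥-elim (¬sq (0<t , trans t²≡d d%p≡d))
      roots y y<p | no ¬sq | no _ | yes refl =
        ⊥-elim (¬sq (m<n⇒0<n∸m t<p , trans ([p∸t]²≡t² t (<⇒≤ t<p)) (trans t²≡d d%p≡d)))
      roots y y<p | no _ | no _ | no _ = refl

    #roots : ∀ d → d < p → ∑[ y < p ] 𝟙 (squaresTo? y d) ≡ 𝟙 (unitQR? d) + 𝟙 (unitQR? d)
    #roots d d<p with unitQR? d
    ... | yes qr = #roots-of-residue d d<p qr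
    ... | no ¬qr = #roots-of-nonresidue d d<p ¬qr

  #unitQR+#unitQR≡p∸1 : #unitQR + #unitQR ≡ p ∸ 1
  #unitQR+#unitQR≡p∸1 = begin
    #unitQR + #unitQR                           ≡⟨ ∑-distrib-+ p _ _ ⟨
    ∑[ d < p ] (𝟙 (unitQR? d) + 𝟙 (unitQR? d))  ≡⟨ ∑-cong p #roots ⟨
    ∑[ d < p ] ∑[ y < p ] 𝟙 (squaresTo? y d)    ≡⟨ ∑-comm p p (λ d y → 𝟙 (squaresTo? y d)) ⟩
    ∑[ y < p ] ∑[ d < p ] 𝟙 (squaresTo? y d)    ≡⟨ ∑-cong p (λ y _ → #squares-of-root y) ⟩
    ∑[ y < p ] 𝟙 (0 <? y)                       ≡⟨ ∑-𝟙-positive p ⟩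
    p ∸ 1                                       ∎
    where open ≡-Reasoning

module Squares (p : ℕ) .{{_ : NonZero p}} (p-prime : Prime p) (p≢2 : p ≢ 2) where

  open PowerCongruence p
  open PrimeModulus p p-prime
  open QuadraticResidues p p-prime p≢2

  private
    [qp]²≡p²q² : ∀ p q → q * p * (q * p) ≡ p * (p * 1) * (q * q)
    [qp]²≡p²q² = solve-∀

    p∣root : ∀ a Y W → (Y * Y) mod^ (2 + a) ≡ p ^ (1 + a) * W → p ∣ Y
    p∣root a Y W Y²≡ with euclidsLemma Y Y p-prime (m%n≡0⇒n∣m (Y * Y) p Y²%p≡0)
      where
      Y²%p≡0 : (Y * Y) % p ≡ 0
      Y²%p≡0 = begin
        (Y * Y) % p                  ≡⟨ mod-p^1 (Y * Y) ⟨
        (Y * Y) mod^ 1               ≡⟨ mod-mod-≤ {1} {2 + a} (Y * Y) (s≤s z≤n) ⟨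
        (Y * Y) mod^ (2 + a) mod^ 1  ≡⟨ cong (_mod^ 1) Y²≡ ⟩
        (p ^ (1 + a) * W) mod^ 1     ≡⟨ mod-p^1 (p ^ (1 + a) * W) ⟩
        (p * p ^ a * W) % p          ≡⟨ cong (_% p) (trans (*-assoc p (p ^ a) W) (*-comm p (p ^ a * W))) ⟩
        (p ^ a * W * p) % p          ≡⟨ m*n%n≡0 (p ^ a * W) p ⟩
        0                            ∎
        where open ≡-Reasoning
    ... | inj₁ p∣Y = p∣Y
    ... | inj₂ p∣Y = p∣Y

  square-valuation : ∀ α Y W → (Y * Y) mod^ suc α ≡ p ^ α * W → W % p ≢ 0 → α % 2 ≡ 0 × QR W
  square-valuation zero Y W Y²≡W _ = refl , Y % p , m%n<n Y p , (begin
    (Y % p * (Y % p)) % p  ≡⟨ %-distribˡ-* Y Y p ⟨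
    (Y * Y) % p            ≡⟨ m%n%n≡m%n (Y * Y) p ⟨
    (Y * Y) % p % p        ≡⟨ cong (_% p) (trans (sym (mod-p^1 (Y * Y))) (trans Y²≡W (*-identityˡ W))) ⟩
    W % p                  ∎)
    where open ≡-Reasoning
  square-valuation (suc zero) Y W Y²≡pW W≢0 with p∣root 0 Y W Y²≡pW
  ... | divides q refl = ⊥-elim (W≢0 (trans (cong (_% p) W≡0) (0%n≡0 p)))
    where
    pW≡0 : p ^ 1 * W ≡ p ^ 1 * 0
    pW≡0 = begin
      p ^ 1 * W                       ≡⟨ Y²≡pW ⟨
      (q * p * (q * p)) mod^ 2        ≡⟨ cong (_mod^ 2) ([qp]²≡p²q² p q) ⟩
      (p ^ 2 * (q * q)) mod^ (2 + 0)  ≡⟨ p^a*-mod 2 0 (q * q) ⟩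
      p ^ 2 * ((q * q) mod^ 0)        ≡⟨ cong (p ^ 2 *_) (n%1≡0 (q * q)) ⟩
      p ^ 2 * 0                       ≡⟨ *-zeroʳ (p ^ 2) ⟩
      0                               ≡⟨ *-zeroʳ (p ^ 1) ⟨
      p ^ 1 * 0                       ∎
      where open ≡-Reasoning
    W≡0 : W ≡ 0
    W≡0 = *-cancelˡ-≡ W 0 (p ^ 1) {{m^n≢0 p 1}} pW≡0
  square-valuation (suc (suc α)) Y W Y²≡p²W W≢0 with p∣root (suc α) Y W Y²≡p²W
  ... | divides q refl = map₁ α-even⇒2+α-even (square-valuation α q W q²≡W W≢0)
    where
    α-even⇒2+α-even : α % 2 ≡ 0 → (2 + α) % 2 ≡ 0
    α-even⇒2+α-even α%2≡0 = trans (cong (_% 2) (+-comm 2 α)) (trans ([m+n]%n≡m%n α 2) α%2≡0)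
    factor : ∀ p P W → p * (p * P) * W ≡ p * (p * 1) * (P * W)
    factor = solve-∀
    q²≡W : (q * q) mod^ suc α ≡ p ^ α * W
    q²≡W = *-cancelˡ-≡ _ _ (p ^ 2) {{m^n≢0 p 2}} (begin
      p ^ 2 * ((q * q) mod^ suc α)    ≡⟨ p^a*-mod 2 (suc α) (q * q) ⟨
      (p ^ 2 * (q * q)) mod^ (3 + α)  ≡⟨ cong (_mod^ (3 + α)) ([qp]²≡p²q² p q) ⟨
      (q * p * (q * p)) mod^ (3 + α)  ≡⟨ Y²≡p²W ⟩
      p ^ (2 + α) * W                 ≡⟨ factor p (p ^ α) W ⟩
      p ^ 2 * (p ^ α * W)             ∎)
      where open ≡-Reasoning

  private
    2%p≢0 : 2 % p ≢ 0
    2%p≢0 2%p≡0 with m≤n⇒m<n∨m≡n (nonTrivial⇒n>1 p {{prime⇒nonTrivial p-prime}})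
    ... | inj₁ 2<p = <⇒≱ 2<p (∣⇒≤ (m%n≡0⇒n∣m 2 p 2%p≡0))
    ... | inj₂ 2≡p = p≢2 (sym 2≡p)

  hensel-step : ∀ n w B → w % p ≢ 0 → w * w ≡ B [mod^ suc n ] →
                ∃ λ j → j < p × (w + j * p ^ suc n) * (w + j * p ^ suc n) ≡ B [mod^ suc (suc n) ]
  hensel-step n w B w≢0 w²≡B = j , j<p , (begin
    ((w + j * N) * (w + j * N)) mod^ (2 + n)  ≡⟨ cong (_mod^ (2 + n)) (expand w j N) ⟩
    (Z + j * j * N * N) mod^ (2 + n)          ≡⟨ %-remove-+ʳ Z (divides (j * j * p ^ n) (regroup p (p ^ n) j)) ⟩
    Z mod^ (2 + n)                            ≡⟨ Z≡B ⟩
    B mod^ (2 + n)                            ∎)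
    where
    open ≡-Reasoning
    N = p ^ suc n
    instance _ = m^n≢0 p (suc n)
    instance _ = m^n≢0 p (2 + n)
    expand : ∀ w j N → (w + j * N) * (w + j * N) ≡ (w * w + 2 * w * j * N) + j * j * N * N
    expand = solve-∀
    regroup : ∀ p P j → j * j * (p * P) * (p * P) ≡ j * j * P * (p * (p * P))
    regroup = solve-∀
    solution = affine-surjective 1 (2 * w) ((w * w) div^ suc n) (B div^ suc n) (unit-* 2 w 2%p≢0 w≢0)
    j = proj₁ solution
    j<p : j < p
    j<p = subst (j <_) (*-identityʳ p) (proj₁ (proj₂ solution))
    digit : ((w * w) div^ suc n + 2 * w * j) % p ≡ B div^ suc n % p
    digit = trans (sym (mod-p^1 _)) (trans (proj₂ (proj₂ solution)) (mod-p^1 _))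
    Z = w * w + 2 * w * j * N
    Z-div : Z div^ suc n ≡ (w * w) div^ suc n + 2 * w * j
    Z-div = trans (+-distrib-/-∣ʳ (w * w) {2 * w * j * N} {N} (divides (2 * w * j) refl))
                  (cong ((w * w) div^ suc n +_) (m*n/n≡m (2 * w * j) N))
    Z≡B : Z ≡ B [mod^ suc (suc n) ]
    Z≡B = ≡-mod-suc {suc n} {Z} {B} (trans ([m+kn]%n≡m%n (w * w) (2 * w * j) N) w²≡B) (trans (cong (_% p) Z-div) digit)

  UnitRoot : (ℕ → ℕ) → ℕ → Set
  UnitRoot U n = ∃ λ w → w < p ^ suc n × w * w ≡ U (suc n) [mod^ suc n ] × w % p ≢ 0

  lift-root : ∀ U → (∀ n → U (suc n) ≡ U n [mod^ n ]) → ∀ n (w : UnitRoot U n) →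
              Σ (UnitRoot U (suc n)) λ w′ → proj₁ w′ mod^ suc n ≡ proj₁ w
  lift-root U U-coh n (w , w< , w²≡U , w≢0) = (w + j * N , w′< , w′²≡U , w′≢0) , w′≡w
    where
    N = p ^ suc n
    step = hensel-step n w (U (2 + n)) w≢0 (trans w²≡U (sym (U-coh (suc n))))
    j = proj₁ step
    j<p : j < p
    j<p = proj₁ (proj₂ step)
    w′²≡U : (w + j * N) * (w + j * N) ≡ U (2 + n) [mod^ 2 + n ]
    w′²≡U = proj₂ (proj₂ step)
    instance _ = m^n≢0 p (suc n)
    w′< : w + j * N < p * N
    w′< = begin-strict
      w + j * N  <⟨ +-monoˡ-< (j * N) w< ⟩
      suc j * N  ≤⟨ *-monoˡ-≤ N j<p ⟩
      p * N      ∎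
      where open ≤-Reasoning
    w′≡w : (w + j * N) mod^ suc n ≡ w
    w′≡w = trans ([m+kn]%n≡m%n w j N) (mod-< {suc n} w<)
    w′≢0 : (w + j * N) % p ≢ 0
    w′≢0 = w≢0 ∘ trans (sym (%-remove-+ʳ w (divides (j * p ^ n) (regroup j p (p ^ n)))))
      where
      regroup : ∀ j p P → j * (p * P) ≡ j * P * p
      regroup = solve-∀

  sqrt-lift : ∀ U → (∀ n → U (suc n) ≡ U n [mod^ n ]) → UnitQR (U 1) →
              Σ (ℤp p) λ y → ∀ n → res y n * res y n ≡ U n [mod^ n ]
  sqrt-lift U U-coh (U₁≢0 , t , t<p , t²≡U₁) = y , y²≡U
    where
    t≢0 : t % p ≢ 0
    t≢0 t%p≡0 = U₁≢0 (trans (sym t²≡U₁) (trans (%-distribˡ-* t t p) (trans (cong (λ z → (z * z) % p) t%p≡0) (0%n≡0 p))))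
    roots : ∀ n → UnitRoot U n
    roots zero    = t , subst (t <_) (sym (*-identityʳ p)) t<p ,
                    trans (mod-p^1 (t * t)) (trans t²≡U₁ (sym (mod-p^1 (U 1)))) , t≢0
    roots (suc n) = proj₁ (lift-root U U-coh n (roots n))
    digits : ℕ → ℕ
    digits zero    = 0
    digits (suc n) = proj₁ (roots n)
    digits-< : ∀ n → digits n < p ^ n
    digits-< zero    = z<s
    digits-< (suc n) = proj₁ (proj₂ (roots n))
    digits-coh : ∀ n → digits (suc n) mod^ n ≡ digits n
    digits-coh zero    = n%1≡0 (digits 1)
    digits-coh (suc n) = proj₂ (lift-root U U-coh n (roots n))
    y : ℤp p
    y = record { res = digits ; res-< = digits-< ; coh = digits-coh }
    y²≡U : ∀ n → digits n * digits n ≡ U n [mod^ n ]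
    y²≡U zero    = trans (n%1≡0 0) (sym (n%1≡0 (U 0)))
    y²≡U (suc n) = proj₁ (proj₂ (proj₂ (roots n)))

module PairCount (p : ℕ) .{{_ : NonZero p}} (p-prime : Prime p) (p≢2 : p ≢ 2) (σ : ℕ) where

  open PowerCongruence p
  open PrimeModulus p p-prime
  open QuadraticResidues p p-prime p≢2

  hit : ℕ → ℕ → ℕ → ℕ
  hit K i j = 𝟙 (unitQRAt? K ((i * j + p ^ K * σ) mod^ suc K))

  #pairs : ℕ → ℕ
  #pairs K = ∑[ i < p ^ suc K ] ∑[ j < p ^ suc K ] hit K i j

  #targets : ∀ K → ∑[ v < p ^ suc K ] 𝟙 (unitQRAt? K v) ≡ #unitQR
  #targets K = trans (∑-blocks p (p ^ K) _) (∑-cong p block)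
    where
    instance _ = m^n≢0 p K
    low : ∀ d r → r < p ^ K → (d * p ^ K + r) mod^ K ≡ r
    low d r r< = trans (cong (_mod^ K) (+-comm (d * p ^ K) r)) (trans ([m+kn]%n≡m%n r d (p ^ K)) (mod-< {K} r<))
    high : ∀ d → (d * p ^ K + 0) div^ K ≡ d
    high d = trans (cong (_div^ K) (+-identityʳ _)) (m*n/n≡m d (p ^ K))
    block : ∀ d → d < p → ∑[ r < p ^ K ] 𝟙 (unitQRAt? K (d * p ^ K + r)) ≡ 𝟙 (unitQR? d)
    block d d<p with unitQR? d
    ... | yes qr = ∑-𝟙-singleton (p ^ K) (λ r → unitQRAt? K (d * p ^ K + r)) 0 (m^n>0 p K)
                     (low d 0 (m^n>0 p K) , subst UnitQR (sym (high d)) qr)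
                     (λ r r< (r≡0 , _) → trans (sym (low d r r<)) r≡0)
    ... | no ¬qr = ∑-zero (p ^ K) none
      where
      none : ∀ r → r < p ^ K → 𝟙 (unitQRAt? K (d * p ^ K + r)) ≡ 0
      none r r< with unitQRAt? K (d * p ^ K + r)
      ... | no _ = refl
      ... | yes (r≡0 , qr) with trans (sym (low d r r<)) r≡0
      ...   | refl = ⊥-elim (¬qr (subst UnitQR (high d) qr))

  #row-unit : ∀ K i → i % p ≢ 0 → ∑[ j < p ^ suc K ] hit K i j ≡ #unitQR
  #row-unit K i i≢0 = trans (∑-reindex (p ^ suc K) φ (λ j _ → m%n<n _ (p ^ suc K)) φ-injective (𝟙 ∘ unitQRAt? K))
                            (#targets K)
    where
    instance _ = m^n≢0 p (suc K)
    φ : ℕ → ℕ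
    φ j = (i * j + p ^ K * σ) mod^ suc K
    φ-injective : ∀ a b → a < p ^ suc K → b < p ^ suc K → φ a ≡ φ b → a ≡ b
    φ-injective a b a< b< φa≡φb = affine-injective (suc K) i (p ^ K * σ) i≢0 a< b<
      (trans (cong (_mod^ suc K) (+-comm _ (i * a))) (trans φa≡φb (cong (_mod^ suc K) (+-comm (i * b) _))))

  #column-unit : ∀ K j → j % p ≢ 0 → ∑[ i < p ^ suc K ] hit K i j ≡ #unitQR
  #column-unit K j j≢0 =
    trans (∑-cong (p ^ suc K) (λ i _ → cong (λ z → 𝟙 (unitQRAt? K ((z + p ^ K * σ) mod^ suc K))) (*-comm i j)))
                               (#row-unit K j j≢0)

  hit-units : ∀ K i j → i % p ≢ 0 → j % p ≢ 0 → hit (suc K) i j ≡ 0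
  hit-units K i j i≢0 j≢0 with unitQRAt? (suc K) ((i * j + p ^ suc K * σ) mod^ (2 + K))
  ... | no _ = refl
  ... | yes (v≡0 , _) = ⊥-elim (unit-* i j i≢0 j≢0 (begin
    (i * j) % p                       ≡⟨ %-remove-+ʳ (i * j) (divides (p ^ K * σ) (regroup p (p ^ K) σ)) ⟨
    v % p                             ≡⟨ mod-p^1 v ⟨
    v mod^ 1                          ≡⟨ mod-mod-≤ {1} {2 + K} v (s≤s z≤n) ⟨
    v mod^ (2 + K) mod^ 1             ≡⟨ mod-mod-≤ {1} {suc K} (v mod^ (2 + K)) (s≤s z≤n) ⟨
    v mod^ (2 + K) mod^ suc K mod^ 1  ≡⟨ cong (_mod^ 1) v≡0 ⟩
    0 mod^ 1                          ≡⟨ 0%n≡0 (p ^ 1) {{m^n≢0 p 1}} ⟩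
    0                                 ∎))
    where
    open ≡-Reasoning
    v = i * j + p ^ suc K * σ
    regroup : ∀ p P σ → p * P * σ ≡ P * σ * p
    regroup = solve-∀

  private
    p²*-div : ∀ K W → (p ^ 2 * W) div^ (2 + K) ≡ W div^ K
    p²*-div K W = trans (/-congʳ {{m^n≢0 p (2 + K)}} {{p²p^K≢0}} (^-distribˡ-+-* p 2 K))
                        (m*n/m*o≡n/o (p ^ 2) W (p ^ K) {{m^n≢0 p K}} {{p²p^K≢0}})
      where
      p²p^K≢0 : NonZero (p ^ 2 * p ^ K)
      p²p^K≢0 = m*n≢0 (p ^ 2) (p ^ K) {{m^n≢0 p 2}} {{m^n≢0 p K}}

  unitQRAt-p²* : ∀ K W → UnitQRAt (2 + K) (p ^ 2 * W) → UnitQRAt K W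
  unitQRAt-p²* K W (p²W≡0 , qr) =
    *-cancelˡ-≡ (W mod^ K) 0 (p ^ 2) {{m^n≢0 p 2}} (trans (sym (p^a*-mod 2 K W)) (trans p²W≡0 (sym (*-zeroʳ (p ^ 2))))) ,
    subst UnitQR (p²*-div K W) qr

  unitQRAt-*p² : ∀ K W → UnitQRAt K W → UnitQRAt (2 + K) (p ^ 2 * W)
  unitQRAt-*p² K W (W≡0 , qr) =
    trans (p^a*-mod 2 K W) (trans (cong (p ^ 2 *_) W≡0) (*-zeroʳ (p ^ 2))) , subst UnitQR (sym (p²*-div K W)) qr

  hit-multiples : ∀ K q q′ → hit (2 + K) (q * p) (q′ * p) ≡ hit K (q mod^ suc K) (q′ mod^ suc K)
  hit-multiples K q q′ = begin
    𝟙 (unitQRAt? (2 + K) ((q * p * (q′ * p) + p ^ (2 + K) * σ) mod^ (3 + K))) ≡⟨ cong (𝟙 ∘ unitQRAt? (2 + K)) factor-p² ⟩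
    𝟙 (unitQRAt? (2 + K) (p ^ 2 * W))                                       ≡⟨ 𝟙-cong (unitQRAt? (2 + K) _) (unitQRAt? K W)
                                                                                 (unitQRAt-p²* K W) (unitQRAt-*p² K W) ⟩
    𝟙 (unitQRAt? K W)                     ≡⟨ cong (𝟙 ∘ unitQRAt? K) W≡ ⟩
    hit K (q mod^ suc K) (q′ mod^ suc K)  ∎
    where
    open ≡-Reasoning
    W = (q * q′ + p ^ K * σ) mod^ suc K
    regroup : ∀ p q q′ P σ → q * p * (q′ * p) + p * (p * P) * σ ≡ p * (p * 1) * (q * q′ + P * σ)
    regroup = solve-∀
    factor-p² : (q * p * (q′ * p) + p ^ (2 + K) * σ) mod^ (3 + K) ≡ p ^ 2 * W
    factor-p² = trans (cong (_mod^ (2 + suc K)) (regroup p q q′ (p ^ K) σ)) (p^a*-mod 2 (suc K) _)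
    W≡ : W ≡ ((q mod^ suc K) * (q′ mod^ suc K) + p ^ K * σ) mod^ suc K
    W≡ = +-cong-mod {suc K} (*-cong-mod {suc K} (sym (mod-≡ (suc K) q)) (sym (mod-≡ (suc K) q′))) refl

  private
    <p∸1⇒suc<p : ∀ {r} → r < p ∸ 1 → suc r < p
    <p∸1⇒suc<p {r} r<p∸1 = subst (suc (suc r) ≤_) (trans (+-comm 1 (p ∸ 1)) (m∸n+n≡m {p} {1} (>-nonZero⁻¹ p)))
                                 (+-monoʳ-≤ 1 r<p∸1)

  residue-unit : ∀ q r → r < p ∸ 1 → (q * p + suc r) % p ≢ 0
  residue-unit q r r<p∸1 qp+r+1≡0 = 1+n≢0 (begin
    suc r                ≡⟨ m<n⇒m%n≡m (<p∸1⇒suc<p r<p∸1) ⟨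
    suc r % p            ≡⟨ [m+kn]%n≡m%n (suc r) q p ⟨
    (suc r + q * p) % p  ≡⟨ cong (_% p) (+-comm (suc r) (q * p)) ⟩
    (q * p + suc r) % p  ≡⟨ qp+r+1≡0 ⟩
    0                    ∎)
    where open ≡-Reasoning

  ∑-by-residue : ∀ K X → ∑< (p ^ suc K) X ≡ ∑[ q < p ^ K ] (X (q * p) + ∑[ r < p ∸ 1 ] X (q * p + suc r))
  ∑-by-residue K X = trans (cong (λ n → ∑< n X) (*-comm p (p ^ K))) (∑-multiples-and-rest (p ^ K) p X)

  #multiples-column-unit : ∀ K j → j % p ≢ 0 → ∑[ q < p ^ (2 + K) ] hit (2 + K) (q * p) j ≡ #unitQR
  #multiples-column-unit K j j≢0 = begin
    ∑[ q < p ^ (2 + K) ] hit (2 + K) (q * p) j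
      ≡⟨ ∑-cong (p ^ (2 + K)) (λ q _ → sym (trans (cong (hit (2 + K) (q * p) j +_) (units-miss q)) (+-identityʳ _))) ⟩
    ∑[ q < p ^ (2 + K) ] (hit (2 + K) (q * p) j + ∑[ r < p ∸ 1 ] hit (2 + K) (q * p + suc r) j)
      ≡⟨ ∑-by-residue (2 + K) (λ i → hit (2 + K) i j) ⟨
    ∑[ i < p ^ (3 + K) ] hit (2 + K) i j
      ≡⟨ #column-unit (2 + K) j j≢0 ⟩
    #unitQR ∎
    where
    open ≡-Reasoning
    units-miss : ∀ q → ∑[ r < p ∸ 1 ] hit (2 + K) (q * p + suc r) j ≡ 0
    units-miss q = ∑-zero (p ∸ 1) (λ r r< → hit-units (suc K) (q * p + suc r) j (residue-unit q r r<) j≢0)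

  #multiples-multiples : ∀ K → ∑[ q < p ^ (2 + K) ] ∑[ q′ < p ^ (2 + K) ] hit (2 + K) (q * p) (q′ * p) ≡ p * (p * #pairs K)
  #multiples-multiples K = begin
    ∑[ q < p ^ (2 + K) ] ∑[ q′ < p ^ (2 + K) ] hit (2 + K) (q * p) (q′ * p)
      ≡⟨ ∑-cong (p ^ (2 + K)) (λ q _ → ∑-cong (p ^ (2 + K)) (λ q′ _ → hit-multiples K q q′)) ⟩
    ∑[ q < p ^ (2 + K) ] ∑[ q′ < p ^ (2 + K) ] hit K (q mod^ suc K) (q′ mod^ suc K)
      ≡⟨ ∑-cong (p ^ (2 + K)) (λ q _ → ∑-periodic p (p ^ suc K) {{m^n≢0 p (suc K)}} (hit K (q mod^ suc K))) ⟩
    ∑[ q < p ^ (2 + K) ] (p * ∑[ j < p ^ suc K ] hit K (q mod^ suc K) j)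
      ≡⟨ ∑-distribˡ-* (p ^ (2 + K)) p _ ⟩
    p * ∑[ q < p ^ (2 + K) ] ∑[ j < p ^ suc K ] hit K (q mod^ suc K) j
      ≡⟨ cong (p *_) (∑-periodic p (p ^ suc K) {{m^n≢0 p (suc K)}} (λ i → ∑[ j < p ^ suc K ] hit K i j)) ⟩
    p * (p * #pairs K) ∎
    where open ≡-Reasoning

  #multiples-units : ∀ K →
    ∑[ q < p ^ (2 + K) ] ∑[ q′ < p ^ (2 + K) ] ∑[ r < p ∸ 1 ] hit (2 + K) (q * p) (q′ * p + suc r)
      ≡ p ^ (2 + K) * ((p ∸ 1) * #unitQR)
  #multiples-units K = begin
    ∑[ q < P ] ∑[ q′ < P ] ∑[ r < p ∸ 1 ] hit (2 + K) (q * p) (q′ * p + suc r)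
      ≡⟨ ∑-comm P P _ ⟩
    ∑[ q′ < P ] ∑[ q < P ] ∑[ r < p ∸ 1 ] hit (2 + K) (q * p) (q′ * p + suc r)
      ≡⟨ ∑-cong P (λ q′ _ → ∑-comm P (p ∸ 1) _) ⟩
    ∑[ q′ < P ] ∑[ r < p ∸ 1 ] ∑[ q < P ] hit (2 + K) (q * p) (q′ * p + suc r)
      ≡⟨ ∑-cong P (λ q′ _ → ∑-cong (p ∸ 1) (λ r r< → #multiples-column-unit K _ (residue-unit q′ r r<))) ⟩
    ∑[ q′ < P ] ∑[ r < p ∸ 1 ] #unitQR
      ≡⟨ ∑-cong P (λ q′ _ → ∑-const (p ∸ 1) _) ⟩
    ∑[ q′ < P ] ((p ∸ 1) * #unitQR)
      ≡⟨ ∑-const P _ ⟩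
    P * ((p ∸ 1) * #unitQR) ∎
    where
    open ≡-Reasoning
    P = p ^ (2 + K)

  #pairs-recurrence : ∀ K → #pairs (2 + K) ≡
    p * (p * #pairs K) + (p ^ (2 + K) * ((p ∸ 1) * #unitQR) + p ^ (2 + K) * ((p ∸ 1) * #unitQR))
  #pairs-recurrence K = begin
    #pairs (2 + K)                                                 ≡⟨ ∑-by-residue (2 + K) row ⟩
    ∑[ q < P ] (row (q * p) + ∑[ r < p ∸ 1 ] row (q * p + suc r))  ≡⟨ ∑-cong P (λ q _ → cong (row (q * p) +_) (unit-rows q)) ⟩
    ∑[ q < P ] (row (q * p) + E)                                   ≡⟨ ∑-distrib-+ P _ _ ⟩
    ∑[ q < P ] row (q * p) + ∑[ _ < P ] E                          ≡⟨ cong₂ _+_ multiple-rows (∑-const P E) ⟩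
    p * (p * #pairs K) + P * E + P * E                             ≡⟨ +-assoc (p * (p * #pairs K)) _ _ ⟩
    p * (p * #pairs K) + (P * E + P * E)                           ∎
    where
    open ≡-Reasoning
    P = p ^ (2 + K)
    E = (p ∸ 1) * #unitQR
    row : ℕ → ℕ
    row i = ∑[ j < p ^ (3 + K) ] hit (2 + K) i j
    unit-rows : ∀ q → ∑[ r < p ∸ 1 ] row (q * p + suc r) ≡ E
    unit-rows q = trans (∑-cong (p ∸ 1) (λ r r< → #row-unit (2 + K) _ (residue-unit q r r<))) (∑-const (p ∸ 1) _)
    multiple-rows : ∑[ q < P ] row (q * p) ≡ p * (p * #pairs K) + P * E
    multiple-rows = begin
      ∑[ q < P ] row (q * p)
        ≡⟨ ∑-cong P (λ q _ → ∑-by-residue (2 + K) (hit (2 + K) (q * p))) ⟩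
      ∑[ q < P ] ∑[ q′ < P ] (hit (2 + K) (q * p) (q′ * p) + ∑[ r < p ∸ 1 ] hit (2 + K) (q * p) (q′ * p + suc r))
        ≡⟨ trans (∑-cong P (λ q _ → ∑-distrib-+ P _ _)) (∑-distrib-+ P _ _) ⟩
      ∑[ q < P ] ∑[ q′ < P ] hit (2 + K) (q * p) (q′ * p)
        + ∑[ q < P ] ∑[ q′ < P ] ∑[ r < p ∸ 1 ] hit (2 + K) (q * p) (q′ * p + suc r)
        ≡⟨ cong₂ _+_ (#multiples-multiples K) (#multiples-units K) ⟩
      p * (p * #pairs K) + P * E ∎

  #pairs-zero : #pairs 0 ≡ p * 𝟙 (unitQR? σ) + (p ∸ 1) * #unitQR
  #pairs-zero = begin
    #pairs 0                                ≡⟨ ∑-by-residue 0 row ⟩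
    row 0 + ∑[ r < p ∸ 1 ] row (suc r) + 0  ≡⟨ +-identityʳ _ ⟩
    row 0 + ∑[ r < p ∸ 1 ] row (suc r)      ≡⟨ cong₂ _+_ row-zero unit-rows ⟩
    p * 𝟙 (unitQR? σ) + (p ∸ 1) * #unitQR   ∎
    where
    open ≡-Reasoning
    row : ℕ → ℕ
    row i = ∑[ j < p ^ 1 ] hit 0 i j
    v = (0 + 1 * σ) mod^ 1
    v≡σ : v div^ 0 ≡ σ % p
    v≡σ = trans (n/1≡n v) (trans (mod-p^1 (0 + 1 * σ)) (cong (_% p) (+-identityʳ σ)))
    hit-zero-row : 𝟙 (unitQRAt? 0 v) ≡ 𝟙 (unitQR? σ)
    hit-zero-row = 𝟙-cong (unitQRAt? 0 v) (unitQR? σ)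
      (λ (_ , qr) → UnitQR-mod σ (subst UnitQR v≡σ qr))
      (λ qr → n%1≡0 v , subst UnitQR (sym v≡σ) (mod-UnitQR σ qr))
    row-zero : row 0 ≡ p * 𝟙 (unitQR? σ)
    row-zero = trans (∑-cong (p ^ 1) (λ _ _ → hit-zero-row))
                     (trans (∑-const (p ^ 1) _) (cong (_* 𝟙 (unitQR? σ)) (*-identityʳ p)))
    unit-rows : ∑[ r < p ∸ 1 ] row (suc r) ≡ (p ∸ 1) * #unitQR
    unit-rows = trans (∑-cong (p ∸ 1) (λ r r< → #row-unit 0 (suc r) (residue-unit 0 r r<))) (∑-const (p ∸ 1) _)

  private
    h = #unitQR

    p≡1+2h : p ≡ suc (h + h)
    p≡1+2h = trans (sym (trans (+-comm 1 (p ∸ 1)) (m∸n+n≡m {p} {1} (>-nonZero⁻¹ p))))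
                   (cong suc (sym #unitQR+#unitQR≡p∸1))

  -- Replacing p ∸ 1 by h + h turns each step below into a semiring identity.
  #pairs-recurrence-doubled : ∀ K → #pairs (2 + K) * 2 ≡ p ^ 2 * (#pairs K * 2) + p ^ (2 + K) * (p ∸ 1) ^ 2 * 2
  #pairs-recurrence-doubled K = trans (cong (_* 2) (#pairs-recurrence K))
    (subst (λ q → (p * (p * #pairs K) + (p ^ (2 + K) * (q * h) + p ^ (2 + K) * (q * h))) * 2
                ≡ p ^ 2 * (#pairs K * 2) + p ^ (2 + K) * q ^ 2 * 2)
           #unitQR+#unitQR≡p∸1 (regroup p h (#pairs K) (p ^ K)))
    where
    regroup : ∀ p e c u → (p * (p * c) + (p * (p * u) * ((e + e) * e) + p * (p * u) * ((e + e) * e))) * 2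
                         ≡ p * (p * 1) * (c * 2) + p * (p * u) * ((e + e) * ((e + e) * 1)) * 2
    regroup = solve-∀

  #pairs-nonresidue : ¬ UnitQR σ → ∀ t → #pairs (t * 2) * 2 ≡ (t * 2 + 1) * (p ∸ 1) ^ 2 * p ^ (t * 2)
  #pairs-nonresidue σ-nonresidue zero = begin
    #pairs 0 * 2
      ≡⟨ cong (_* 2) #pairs-zero ⟩
    (p * 𝟙 (unitQR? σ) + (p ∸ 1) * h) * 2
      ≡⟨ cong (λ z → (p * z + (p ∸ 1) * h) * 2) (𝟙-no (unitQR? σ) σ-nonresidue) ⟩
    (p * 0 + (p ∸ 1) * h) * 2
      ≡⟨ subst (λ q → (p * 0 + q * h) * 2 ≡ 1 * q ^ 2 * 1) #unitQR+#unitQR≡p∸1 (base p h) ⟩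
    1 * (p ∸ 1) ^ 2 * 1 ∎
    where
    open ≡-Reasoning
    base : ∀ p e → (p * 0 + (e + e) * e) * 2 ≡ 1 * ((e + e) * ((e + e) * 1)) * 1
    base = solve-∀
  #pairs-nonresidue σ-nonresidue (suc t) = begin
    #pairs (2 + t * 2) * 2
      ≡⟨ #pairs-recurrence-doubled (t * 2) ⟩
    p ^ 2 * (#pairs (t * 2) * 2) + p ^ (2 + t * 2) * (p ∸ 1) ^ 2 * 2
      ≡⟨ cong (λ z → p ^ 2 * z + p ^ (2 + t * 2) * (p ∸ 1) ^ 2 * 2) (#pairs-nonresidue σ-nonresidue t) ⟩
    p ^ 2 * ((t * 2 + 1) * (p ∸ 1) ^ 2 * P) + p * (p * P) * (p ∸ 1) ^ 2 * 2
      ≡⟨ regroup p (p ∸ 1) P t ⟩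
    (2 + t * 2 + 1) * (p ∸ 1) ^ 2 * p ^ (2 + t * 2) ∎
    where
    open ≡-Reasoning
    P = p ^ (t * 2)
    regroup : ∀ p q u t → (p * (p * 1)) * ((t * 2 + 1) * (q * (q * 1)) * u) + p * (p * u) * (q * (q * 1)) * 2
                         ≡ (2 + t * 2 + 1) * (q * (q * 1)) * (p * (p * u))
    regroup = solve-∀

  #pairs-residue : UnitQR σ → ∀ t → #pairs (t * 2) * 2 ≡ (t * 2 * (p ∸ 1) ^ 2 + p ^ 2 + 1) * p ^ (t * 2)
  #pairs-residue σ-residue zero = begin
    #pairs 0 * 2
      ≡⟨ cong (_* 2) #pairs-zero ⟩
    (p * 𝟙 (unitQR? σ) + (p ∸ 1) * h) * 2
      ≡⟨ cong (λ z → (p * z + (p ∸ 1) * h) * 2) (𝟙-yes (unitQR? σ) σ-residue) ⟩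
    (p * 1 + (p ∸ 1) * h) * 2
      ≡⟨ cong (λ q → (p * 1 + q * h) * 2) #unitQR+#unitQR≡p∸1 ⟨
    (p * 1 + (h + h) * h) * 2
      ≡⟨ subst (λ p → (p * 1 + (h + h) * h) * 2 ≡ (0 * 2 * (p ∸ 1) ^ 2 + p ^ 2 + 1) * 1) (sym p≡1+2h) (base h) ⟩
    (0 * 2 * (p ∸ 1) ^ 2 + p ^ 2 + 1) * 1 ∎
    where
    open ≡-Reasoning
    base : ∀ e → (suc (e + e) * 1 + (e + e) * e) * 2
                  ≡ (0 * 2 * ((e + e) * ((e + e) * 1)) + suc (e + e) * (suc (e + e) * 1) + 1) * 1
    base = solve-∀
  #pairs-residue σ-residue (suc t) = begin
    #pairs (2 + t * 2) * 2
      ≡⟨ #pairs-recurrence-doubled (t * 2) ⟩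
    p ^ 2 * (#pairs (t * 2) * 2) + p ^ (2 + t * 2) * (p ∸ 1) ^ 2 * 2
      ≡⟨ cong (λ z → p ^ 2 * z + p ^ (2 + t * 2) * (p ∸ 1) ^ 2 * 2) (#pairs-residue σ-residue t) ⟩
    p ^ 2 * ((t * 2 * (p ∸ 1) ^ 2 + p ^ 2 + 1) * P) + p * (p * P) * (p ∸ 1) ^ 2 * 2
      ≡⟨ regroup p (p ∸ 1) P t ⟩
    ((2 + t * 2) * (p ∸ 1) ^ 2 + p ^ 2 + 1) * p ^ (2 + t * 2) ∎
    where
    open ≡-Reasoning
    P = p ^ (t * 2)
    regroup : ∀ p q u t → (p * (p * 1)) * ((t * 2 * (q * (q * 1)) + (p * (p * 1)) + 1) * u)
                           + p * (p * u) * (q * (q * 1)) * 2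
                         ≡ ((2 + t * 2) * (q * (q * 1)) + (p * (p * 1)) + 1) * (p * (p * u))
    regroup = solve-∀

module PAdic (p : ℕ) .{{_ : NonZero p}} where

  open PowerCongruence p

  Coherent : (ℕ → ℕ) → Set
  Coherent f = ∀ {m n} → m ≤ n → f n ≡ f m [mod^ m ]

  res-mod-≤ : ∀ (x : ℤp p) {m n} → m ≤ n → res x n mod^ m ≡ res x m
  res-mod-≤ x {m} {zero}  z≤n = mod-< {0} (res-< x 0)
  res-mod-≤ x {m} {suc n} m≤1+n with m≤n⇒m<n∨m≡n m≤1+n
  ... | inj₂ refl  = mod-< {suc n} (res-< x (suc n))
  ... | inj₁ m<1+n = begin
    res x (suc n) mod^ m         ≡⟨ mod-mod-≤ (res x (suc n)) m≤n ⟨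
    res x (suc n) mod^ n mod^ m  ≡⟨ cong (_mod^ m) (coh x n) ⟩
    res x n mod^ m               ≡⟨ res-mod-≤ x m≤n ⟩
    res x m                      ∎
    where
    open ≡-Reasoning
    m≤n : m ≤ n
    m≤n = s≤s⁻¹ m<1+n

  res-coherent : ∀ (x : ℤp p) → Coherent (res x)
  res-coherent x {m} m≤n = trans (res-mod-≤ x m≤n) (sym (mod-< {m} (res-< x m)))

  mulAdd-coherent : ∀ (a b r : ℤp p) → Coherent (mulAdd a b r)
  mulAdd-coherent a b r {m} {n} m≤n =
    +-cong-mod {m} {res a n * res b n} {res a m * res b m} {res r n} {res r m}
      (*-cong-mod {m} {res a n} {res a m} {res b n} {res b m} (res-coherent a m≤n) (res-coherent b m≤n))
      (res-coherent r m≤n)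

  fromℕ : ℕ → ℤp p
  fromℕ i = record
    { res   = λ n → i mod^ n
    ; res-< = λ n → m%n<n i (p ^ n) {{m^n≢0 p n}}
    ; coh   = λ n → mod-mod-≤ i (n≤1+n n)
    }

  scale : ℕ → ℤp p → ℤp p
  scale c x = record
    { res   = λ n → (c * res x n) mod^ n
    ; res-< = λ n → m%n<n (c * res x n) (p ^ n) {{m^n≢0 p n}}
    ; coh   = λ n → trans (mod-mod-≤ (c * res x (suc n)) (n≤1+n n))
                          (*-cong-mod {n} {c} refl (res-coherent x (n≤1+n n)))
    }

module SquareClasses (p : ℕ) .{{_ : NonZero p}} (p-prime : Prime p) (p≢2 : p ≢ 2) where

  open PowerCongruence p
  open QuadraticResidues p p-prime p≢2
  open Squares p p-prime p≢2
  open PAdic p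

  unit-part : ∀ α X → X mod^ α ≡ 0 → X ≡ p ^ α * (X div^ α)
  unit-part α X X≡0 = begin
    X                            ≡⟨ m≡m%n+[m/n]*n X (p ^ α) ⟩
    X mod^ α + X div^ α * p ^ α  ≡⟨ cong (_+ X div^ α * p ^ α) X≡0 ⟩
    X div^ α * p ^ α             ≡⟨ *-comm (X div^ α) (p ^ α) ⟩
    p ^ α * (X div^ α)           ∎
    where
    open ≡-Reasoning
    instance _ = m^n≢0 p α

  square⇒unitQRAt : ∀ {f} α → Coherent f → IsSquare p f → HasVal p f α →
                    α % 2 ≡ 0 × UnitQRAt α (f (suc α) mod^ suc α)
  square⇒unitQRAt {f} α f-coh (y , y²≡f) (fα≡0 , X≢0) =
    map₂ (λ qr → Xα≡0 , W≢0 , qr) (square-valuation α (res y (suc α)) W y²≡p^αW W≢0)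
    where
    X = f (suc α) mod^ suc α
    W = X div^ α
    Xα≡0 : X mod^ α ≡ 0
    Xα≡0 = trans (mod-mod-≤ (f (suc α)) (n≤1+n α)) (trans (f-coh (n≤1+n α)) fα≡0)
    X≡p^αW : X ≡ p ^ α * W
    X≡p^αW = unit-part α X Xα≡0
    W<p : W < p
    W<p = m<n*o⇒m/o<n {{m^n≢0 p α}} (m%n<n (f (suc α)) (p ^ suc α) {{m^n≢0 p (suc α)}})
    W≢0 : W % p ≢ 0
    W≢0 W%p≡0 = X≢0 (begin
      X          ≡⟨ X≡p^αW ⟩
      p ^ α * W  ≡⟨ cong (p ^ α *_) (trans (sym (m<n⇒m%n≡m W<p)) W%p≡0) ⟩
      p ^ α * 0  ≡⟨ *-zeroʳ (p ^ α) ⟩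
      0          ∎)
      where open ≡-Reasoning
    y²≡p^αW : (res y (suc α) * res y (suc α)) mod^ suc α ≡ p ^ α * W
    y²≡p^αW = trans (y²≡f (suc α)) X≡p^αW

  unitPart : (ℕ → ℕ) → ℕ → ℕ → ℕ
  unitPart f α n = (f (n + α) mod^ (n + α)) div^ α

  module _ {f : ℕ → ℕ} (α : ℕ) (f-coh : Coherent f) (fα≡0 : f α mod^ α ≡ 0) where

    p^α*unitPart : ∀ n → p ^ α * unitPart f α n ≡ f (n + α) mod^ (n + α)
    p^α*unitPart n = sym (unit-part α (f (n + α) mod^ (n + α))
      (trans (mod-mod-≤ (f (n + α)) (m≤n+m α n)) (trans (f-coh (m≤n+m α n)) fα≡0)))

    unitPart-coh : ∀ n → unitPart f α (suc n) ≡ unitPart f α n [mod^ n ]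
    unitPart-coh n = p^a*-cancel-mod α n _ _ (begin
      (p ^ α * unitPart f α (suc n)) mod^ (α + n)   ≡⟨ cong (_mod^ (α + n)) (p^α*unitPart (suc n)) ⟩
      f (suc n + α) mod^ (suc n + α) mod^ (α + n)   ≡⟨ mod-mod-≤ (f (suc n + α)) α+n≤ ⟩
      f (suc n + α) mod^ (α + n)                    ≡⟨ f-coh α+n≤ ⟩
      f (α + n) mod^ (α + n)                        ≡⟨ cong (λ z → f z mod^ (α + n)) (+-comm α n) ⟩
      f (n + α) mod^ (α + n)                        ≡⟨ mod-mod-≤ (f (n + α)) (≤-reflexive (+-comm α n)) ⟨
      f (n + α) mod^ (n + α) mod^ (α + n)           ≡⟨ cong (_mod^ (α + n)) (p^α*unitPart n) ⟨
      (p ^ α * unitPart f α n) mod^ (α + n)         ∎)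
      where
      open ≡-Reasoning
      α+n≤ : α + n ≤ suc n + α
      α+n≤ = ≤-trans (≤-reflexive (+-comm α n)) (n≤1+n (n + α))

  p^[α/2]²≡p^α : ∀ α → α % 2 ≡ 0 → p ^ (α / 2) * p ^ (α / 2) ≡ p ^ α
  p^[α/2]²≡p^α α α-even = begin
    p ^ m * p ^ m          ≡⟨ ^-distribˡ-+-* p m m ⟨
    p ^ (m + m)            ≡⟨ cong (p ^_) (double m) ⟩
    p ^ (0 + m * 2)        ≡⟨ cong (λ z → p ^ (z + m * 2)) α-even ⟨
    p ^ (α % 2 + m * 2)    ≡⟨ cong (p ^_) (m≡m%n+[m/n]*n α 2) ⟨
    p ^ α                  ∎
    where
    open ≡-Reasoning
    m = α / 2
    double : ∀ m → m + m ≡ 0 + m * 2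
    double = solve-∀

  scale-square : ∀ c (w : ℤp p) n → res (scale c w) n * res (scale c w) n ≡ c * c * (res w n * res w n) [mod^ n ]
  scale-square c w n = begin
    (res (scale c w) n * res (scale c w) n) mod^ n   ≡⟨ *-cong-mod {n} (mod-≡ n (c * res w n)) (mod-≡ n (c * res w n)) ⟩
    (c * res w n * (c * res w n)) mod^ n             ≡⟨ cong (_mod^ n) (interchange c (res w n)) ⟩
    (c * c * (res w n * res w n)) mod^ n             ∎
    where
    open ≡-Reasoning
    interchange : ∀ c w → c * w * (c * w) ≡ c * c * (w * w)
    interchange = solve-∀

  unitQRAt⇒square : ∀ {f} α → Coherent f → α % 2 ≡ 0 → UnitQRAt α (f (suc α) mod^ suc α) →
                    IsSquare p f × HasVal p f α
  unitQRAt⇒square {f} α f-coh α-even (Xα≡0 , unit-qr) = (y , y²≡f) , fα≡0 , X≢0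
    where
    X = f (suc α) mod^ suc α
    fα≡0 : f α mod^ α ≡ 0
    fα≡0 = trans (sym (f-coh (n≤1+n α))) (trans (sym (mod-mod-≤ (f (suc α)) (n≤1+n α))) Xα≡0)
    X≢0 : X ≢ 0
    X≢0 X≡0 with m*n≡0⇒m≡0∨n≡0 (p ^ α) (trans (sym (unit-part α X Xα≡0)) X≡0)
    ... | inj₁ p^α≡0 = ≢-nonZero⁻¹ (p ^ α) {{m^n≢0 p α}} p^α≡0
    ... | inj₂ W≡0   = proj₁ unit-qr (trans (cong (_% p) W≡0) (0%n≡0 p))
    w = proj₁ (sqrt-lift (unitPart f α) (unitPart-coh α f-coh fα≡0) unit-qr)
    w²≡U = proj₂ (sqrt-lift (unitPart f α) (unitPart-coh α f-coh fα≡0) unit-qr)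
    y : ℤp p
    y = scale (p ^ (α / 2)) w
    y²≡f : ∀ n → (res y n * res y n) mod^ n ≡ f n mod^ n
    y²≡f n = begin
      (res y n * res y n) mod^ n
        ≡⟨ scale-square (p ^ (α / 2)) w n ⟩
      (p ^ (α / 2) * p ^ (α / 2) * (res w n * res w n)) mod^ n
        ≡⟨ cong (λ c → (c * (res w n * res w n)) mod^ n) (p^[α/2]²≡p^α α α-even) ⟩
      (p ^ α * (res w n * res w n)) mod^ n
        ≡⟨ *-cong-mod {n} {p ^ α} refl (w²≡U n) ⟩
      (p ^ α * unitPart f α n) mod^ n
        ≡⟨ cong (_mod^ n) (p^α*unitPart α f-coh fα≡0 n) ⟩
      f (n + α) mod^ (n + α) mod^ n
        ≡⟨ mod-mod-≤ (f (n + α)) (m≤m+n n α) ⟩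
      f (n + α) mod^ n
        ≡⟨ f-coh (m≤m+n n α) ⟩
      f n mod^ n ∎
      where open ≡-Reasoning

module MeasureOfB (p : ℕ) .{{_ : NonZero p}} (p-prime : Prime p) (p≢2 : p ≢ 2)
                  (r s : ℤp p) (α : ℕ) (r≡p^αs : ∀ n → (p ^ α * res s n) mod p ^ n ≡ res r n) where

  open PowerCongruence p
  open QuadraticResidues p p-prime p≢2
  open SquareClasses p p-prime p≢2
  open PAdic p
  open PairCount p p-prime p≢2 (res s 1)

  target : ℕ → ℕ → ℕ
  target i j = (i * j + p ^ α * res s 1) mod^ suc α

  res-r : res r (suc α) ≡ p ^ α * res s 1
  res-r = begin
    res r (suc α)                         ≡⟨ r≡p^αs (suc α) ⟨
    (p ^ α * res s (suc α)) mod^ suc α    ≡⟨ cong ((p ^ α * res s (suc α)) mod^_) (+-comm 1 α) ⟩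
    (p ^ α * res s (suc α)) mod^ (α + 1)  ≡⟨ p^a*-mod α 1 (res s (suc α)) ⟩
    p ^ α * (res s (suc α) mod^ 1)        ≡⟨ cong (p ^ α *_) (res-mod-≤ s (s≤s z≤n)) ⟩
    p ^ α * res s 1                       ∎
    where open ≡-Reasoning

  top-residue : ∀ a b → mulAdd a b r (suc α) mod^ suc α ≡ target (res a (suc α)) (res b (suc α))
  top-residue a b = cong (λ z → (res a (suc α) * res b (suc α) + z) mod^ suc α) res-r

  B⇒unitQRAt : ∀ a b → B p r α a b → α % 2 ≡ 0 × UnitQRAt α (target (res a (suc α)) (res b (suc α)))
  B⇒unitQRAt a b (square , val) = map₂ (subst (UnitQRAt α) (top-residue a b))
                                    (square⇒unitQRAt α (mulAdd-coherent a b r) square val)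

  unitQRAt⇒B : ∀ a b → α % 2 ≡ 0 → UnitQRAt α (target (res a (suc α)) (res b (suc α))) → B p r α a b
  unitQRAt⇒B a b α-even qr =
    unitQRAt⇒square α (mulAdd-coherent a b r) α-even (subst (UnitQRAt α) (sym (top-residue a b)) qr)

  B-odd-empty : α % 2 ≡ 1 → ∀ a b → ¬ B p r α a b
  B-odd-empty α-odd a b Bab with trans (sym α-odd) (proj₁ (B⇒unitQRAt a b Bab))
  ... | ()

  B-local : ∀ a a′ b b′ → res a (suc α) ≡ res a′ (suc α) → res b (suc α) ≡ res b′ (suc α) →
            B p r α a b → B p r α a′ b′
  B-local a a′ b b′ a≡a′ b≡b′ Bab with B⇒unitQRAt a b Bab
  ... | α-even , qr = unitQRAt⇒B a′ b′ α-even (subst₂ (λ i j → UnitQRAt α (target i j)) a≡a′ b≡b′ qr)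

  residuePairs : List (ℕ × ℕ)
  residuePairs = cartesianProduct (upTo (p ^ suc α)) (upTo (p ^ suc α))

  hits : List (ℕ × ℕ)
  hits = filter (unitQRAt? α ∘ uncurry target) residuePairs

  hits-unique : Unique hits
  hits-unique = Unique.filter⁺ (unitQRAt? α ∘ uncurry target)
                  (Unique.cartesianProduct⁺ (Unique.upTo⁺ (p ^ suc α)) (Unique.upTo⁺ (p ^ suc α)))

  length-hits : length hits ≡ #pairs α
  length-hits = begin
    length hits
      ≡⟨ length-filter≡sum-𝟙 (unitQRAt? α ∘ uncurry target) residuePairs ⟩
    sum (map (𝟙 ∘ unitQRAt? α ∘ uncurry target) residuePairs)
      ≡⟨ sum-map-cartesianProduct (upTo (p ^ suc α)) (upTo (p ^ suc α)) _ ⟩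
    sum (map (λ i → sum (map (λ j → 𝟙 (unitQRAt? α (target i j))) (upTo (p ^ suc α)))) (upTo (p ^ suc α)))
      ≡⟨ sum-map-upTo (p ^ suc α) _ ⟩
    ∑[ i < p ^ suc α ] sum (map (λ j → 𝟙 (unitQRAt? α (target i j))) (upTo (p ^ suc α)))
      ≡⟨ ∑-cong (p ^ suc α) (λ i _ → sum-map-upTo (p ^ suc α) _) ⟩
    #pairs α ∎
    where open ≡-Reasoning

  ∈-hits⇔B : α % 2 ≡ 0 → ∀ i j → (i , j) ∈ hits ⇔
             (Σ (ℤp p) λ a → Σ (ℤp p) λ b → (res a (suc α) ≡ i) × (res b (suc α) ≡ j) × B p r α a b)
  ∈-hits⇔B α-even i j = mk⇔ to from
    where
    to : (i , j) ∈ hits → Σ (ℤp p) λ a → Σ (ℤp p) λ b → (res a (suc α) ≡ i) × (res b (suc α) ≡ j) × B p r α a b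
    to ij∈hits with ∈-filter⁻ (unitQRAt? α ∘ uncurry target) ij∈hits
    ... | ij∈ , qr with ∈-cartesianProduct⁻ (upTo (p ^ suc α)) (upTo (p ^ suc α)) ij∈
    ...   | i∈ , j∈ = fromℕ i , fromℕ j , i≡ , j≡ ,
                      unitQRAt⇒B (fromℕ i) (fromℕ j) α-even (subst₂ (λ u v → UnitQRAt α (target u v)) (sym i≡) (sym j≡) qr)
      where
      i≡ : i mod^ suc α ≡ i
      i≡ = mod-< {suc α} (∈-upTo⁻ i∈)
      j≡ : j mod^ suc α ≡ j
      j≡ = mod-< {suc α} (∈-upTo⁻ j∈)
    from : (Σ (ℤp p) λ a → Σ (ℤp p) λ b → (res a (suc α) ≡ i) × (res b (suc α) ≡ j) × B p r α a b) → (i , j) ∈ hits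
    from (a , b , refl , refl , Bab) = ∈-filter⁺ (unitQRAt? α ∘ uncurry target)
      (∈-cartesianProduct⁺ (∈-upTo⁺ (res-< a (suc α))) (∈-upTo⁺ (res-< b (suc α)))) (proj₂ (B⇒unitQRAt a b Bab))

  measure-even : α % 2 ≡ 0 → ∀ c → #pairs α * 2 ≡ c * p ^ α → HasMeasure p (B p r α) c (2 * p ^ (α + 2))
  measure-even α-even c count = suc α , B-local , hits , hits-unique , ∈-hits⇔B α-even , (begin
    length hits * (2 * p ^ (α + 2))  ≡⟨ cong (_* (2 * p ^ (α + 2))) length-hits ⟩
    #pairs α * (2 * p ^ (α + 2))     ≡⟨ *-assoc (#pairs α) 2 _ ⟨
    #pairs α * 2 * p ^ (α + 2)       ≡⟨ cong (_* p ^ (α + 2)) count ⟩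
    c * p ^ α * p ^ (α + 2)          ≡⟨ *-assoc c (p ^ α) _ ⟩
    c * (p ^ α * p ^ (α + 2))        ≡⟨ cong (c *_) (^-distribˡ-+-* p α (α + 2)) ⟨
    c * p ^ (α + (α + 2))            ≡⟨ cong (λ e → c * p ^ e) (exponent α) ⟩
    c * p ^ (2 * suc α)              ∎)
    where
    open ≡-Reasoning
    exponent : ∀ α → α + (α + 2) ≡ 2 * suc α
    exponent = solve-∀

  measure-odd : α % 2 ≡ 1 → HasMeasure p (B p r α) 0 1
  measure-odd α-odd = 0 , (λ a _ b _ _ _ Bab → ⊥-elim (B-odd-empty α-odd a b Bab)) , [] , AllPairs.[] ,
    (λ i j → mk⇔ (λ ()) (λ (a , b , _ , _ , Bab) → ⊥-elim (B-odd-empty α-odd a b Bab))) , refl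

  α≡α/2*2 : α % 2 ≡ 0 → α ≡ α / 2 * 2
  α≡α/2*2 α-even = trans (m≡m%n+[m/n]*n α 2) (cong (_+ α / 2 * 2) α-even)

  #pairs-even-nonresidue : α % 2 ≡ 0 → ¬ UnitQR (res s 1) → #pairs α * 2 ≡ (α + 1) * (p ∸ 1) ^ 2 * p ^ α
  #pairs-even-nonresidue α-even nonresidue =
    subst (λ a → #pairs a * 2 ≡ (a + 1) * (p ∸ 1) ^ 2 * p ^ a) (sym (α≡α/2*2 α-even)) (#pairs-nonresidue nonresidue (α / 2))

  #pairs-even-residue : α % 2 ≡ 0 → UnitQR (res s 1) → #pairs α * 2 ≡ (α * (p ∸ 1) ^ 2 + p ^ 2 + 1) * p ^ α
  #pairs-even-residue α-even residue =
    subst (λ a → #pairs a * 2 ≡ (a * (p ∸ 1) ^ 2 + p ^ 2 + 1) * p ^ a) (sym (α≡α/2*2 α-even)) (#pairs-residue residue (α / 2))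

open import Data.Integer using (+_; -[1+_])

module LegendreSymbol (p : ℕ) .{{_ : NonZero p}} (p-prime : Prime p) (p≢2 : p ≢ 2) where

  open PowerCongruence p
  open QuadraticResidues p p-prime p≢2

  legendre≡-1⇒¬UnitQR : ∀ x → legendre p x ≡ -[1+ 0 ] → ¬ UnitQR x
  legendre≡-1⇒¬UnitQR x _ with x mod p ^ 1 ≟ 0
  legendre≡-1⇒¬UnitQR x () | yes _
  ... | no _ with any? (λ (y : Fin p) → (toℕ y * toℕ y) mod p ^ 1 ≟ x mod p ^ 1)
  legendre≡-1⇒¬UnitQR x () | no _ | yes _
  ... | no no-root = λ (_ , y , y<p , y²≡x) → no-root (fromℕ< y<p ,
    trans (mod-p^1 _) (trans (cong (λ z → (z * z) % p) (toℕ-fromℕ< y<p)) (trans y²≡x (sym (mod-p^1 x)))))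

  legendre≡1⇒UnitQR : ∀ x → legendre p x ≡ + 1 → UnitQR x
  legendre≡1⇒UnitQR x _ with x mod p ^ 1 ≟ 0
  legendre≡1⇒UnitQR x () | yes _
  ... | no x≢0 with any? (λ (y : Fin p) → (toℕ y * toℕ y) mod p ^ 1 ≟ x mod p ^ 1)
  legendre≡1⇒UnitQR x () | no _ | no _
  ... | yes (y , y²≡x) = x≢0 ∘ trans (mod-p^1 x) , toℕ y , toℕ<n y , trans (sym (mod-p^1 _)) (trans y²≡x (mod-p^1 x))

lemma3p7 : (p : ℕ) .{{_ : NonZero p}} → Prime p → p ≢ 2 →
    (r s : ℤp p) (α : ℕ) → 0 < α → HasVal p (res r) α →
    res s 1 ≢ 0 → (∀ n → (p ^ α * res s n) mod p ^ n ≡ res r n) →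
    ((α % 2 ≡ 0 → legendre p (res s 1) ≡ -[1+ 0 ] →
        HasMeasure p (B p r α) ((α + 1) * (p ∸ 1) ^ 2) (2 * p ^ (α + 2)))
    × (α % 2 ≡ 0 → legendre p (res s 1) ≡ + 1 →
        HasMeasure p (B p r α) (α * (p ∸ 1) ^ 2 + p ^ 2 + 1) (2 * p ^ (α + 2)))
    × (α % 2 ≡ 1 → HasMeasure p (B p r α) 0 1))
lemma3p7 p p-prime p≢2 r s α _ _ _ r≡p^αs = nonresidue-case , residue-case , measure-odd
  where
  open MeasureOfB p p-prime p≢2 r s α r≡p^αs
  open LegendreSymbol p p-prime p≢2
  nonresidue-case : α % 2 ≡ 0 → legendre p (res s 1) ≡ -[1+ 0 ] →
                    HasMeasure p (B p r α) ((α + 1) * (p ∸ 1) ^ 2) (2 * p ^ (α + 2))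
  nonresidue-case α-even s-nonresidue = measure-even α-even ((α + 1) * (p ∸ 1) ^ 2)
    (#pairs-even-nonresidue α-even (legendre≡-1⇒¬UnitQR (res s 1) s-nonresidue))
  residue-case : α % 2 ≡ 0 → legendre p (res s 1) ≡ + 1 →
                 HasMeasure p (B p r α) (α * (p ∸ 1) ^ 2 + p ^ 2 + 1) (2 * p ^ (α + 2))
  residue-case α-even s-residue = measure-even α-even (α * (p ∸ 1) ^ 2 + p ^ 2 + 1)
    (#pairs-even-residue α-even (legendre≡1⇒UnitQR (res s 1) s-residue))
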